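{- Define numbers $b(n,k,q)$ for integers $n\ge0$ and $0\le k\le 1+\lfloor n/2\rfloor$ by: $b(n,0,q)=0$ for all $n$; $b(0,1,q)=1$, $b(1,1,q)=1+q$; $b(2n,n+1,q)=0$ for $n\ge1$; $$b(2n+1,k,q)=q^{2k-2}b(2n+1,k-1,q)+(1+q^{2k-1})b(2n,k,q)\quad (n\ge0,\ 1\le k\le n+1),$$ $$b(2n,k,q)=q^{1-2k}\big(b(2n,k+1,q)+(1+q^{2k})b(2n-1,k,q)\big)\quad (n\ge1,\ 1\le k\le n).$$ Let $\lambda$ be the linear functional on polynomials in $s$ determined by $\lambda(U_{2n}(1,s,q))=[n=0]$ for all $n\ge0$. Then for every $n\ge 1$, $$b(2n-1,n,q)=\lambda\big((-1)^{n-1}U_{2n-1}(1,s,q)\big)=(-q;q)_{2n-1}G_{2n}(q).$$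
   Context: Let $q$ be a real number with $q\neq -1$ and $q\neq 0$. Let $[m]=1+q+\dots+q^{m-1}$, $[m]!=[1]\cdots[m]$, $(a;q)_m=(1-a)(1-aq)\cdots(1-aq^{m-1})$, and $[P]$ is $1$ if $P$ holds and $0$ otherwise. $U_{ -1}(x,s,q)=0$, $U_0(x,s,q)=1$, $U_n(x,s,q)=(1+q^{n})xU_{n-1}(x,s,q)+q^{n-1}sU_{n-2}(x,s,q)$ for $n\ge 1$; $U_{2n}(1,s,q)$ is a polynomial in $s$ of degree $n$, so these form a basis of the polynomials in $s$. The $q$-exponential is $e(z)=\sum_{n\ge0}z^n/[n]!$, and the $q$-Genocchi numbers $G_{2n}(q)$, $n\ge1$, are defined by $z\frac{e(z)-e(-z)}{e(z)+e(-z)}=\sum_{n\ge1}\frac{(-1)^{n-1}G_{2n}(q)(-q;q)_{2n-1}}{[2n]!}z^{2n}$. -}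

module Defs where

open import Level using (Level; _⊔_) renaming (suc to lsuc)
open import Algebra.Bundles using (CommutativeRing)
open import Data.Nat using (ℕ; zero; suc; _∸_) renaming (_*_ to _*ℕ_)
open import Data.List using (List; []; _∷_)
open import Data.Product using (_×_; _,_; proj₁; proj₂)
open import Relation.Nullary using (¬_)
open import Data.Bool using (Bool; true; false)

-- A field: a commutative ring with 0 ≠ 1 and a (total) inverse operation
-- that is a two-sided inverse on nonzero elements (the value at 0 is junk).
record Field (c ℓ : Level) : Set (lsuc (c ⊔ ℓ)) where
  field
    commutativeRing : CommutativeRing c ℓ
  open CommutativeRing commutativeRing public
  field
    _⁻¹     : Carrier → Carrier
    ⁻¹-cong : ∀ {x y} → x ≈ y → x ⁻¹ ≈ y ⁻¹
    0≉1     : ¬ (0# ≈ 1#)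
    inverse : ∀ x → ¬ (x ≈ 0#) → x * x ⁻¹ ≈ 1#

halfParity : ℕ → ℕ × Bool
halfParity zero    = zero , false
halfParity (suc n) with halfParity n
... | h , false = h , true
... | h , true  = suc h , false

module FieldDefs {c ℓ : Level} (F : Field c ℓ) where
  open Field F using (Carrier; _≈_; _+_; _-_; -_; 0#; 1#; _⁻¹) renaming (_*_ to _·_)

  pow : Carrier → ℕ → Carrier
  pow x zero    = 1#
  pow x (suc n) = x · pow x n

  fromℕ : ℕ → Carrier
  fromℕ zero    = 0#
  fromℕ (suc m) = 1# + fromℕ m

  sumTo : ℕ → (ℕ → Carrier) → Carrier
  sumTo zero    f = 0#
  sumTo (suc n) f = sumTo n f + f n

  iv0 : ℕ → Carrier
  iv0 zero    = 1#
  iv0 (suc _) = 0#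

  -- Polynomials in s as coefficient lists (constant term first).
  Poly : Set c
  Poly = List Carrier

  _⊕_ : Poly → Poly → Poly
  []       ⊕ p        = p
  (a ∷ p)  ⊕ []       = a ∷ p
  (a ∷ p)  ⊕ (b ∷ p') = (a + b) ∷ (p ⊕ p')

  scale : Carrier → Poly → Poly
  scale a []      = []
  scale a (b ∷ p) = (a · b) ∷ scale a p

  times-s : Poly → Poly
  times-s p = 0# ∷ p

  -- The linear functional on polynomials in s with moments μ k = λ(s^k).
  applyL : (ℕ → Carrier) → Poly → Carrier
  applyL μ []      = 0#
  applyL μ (a ∷ p) = a · μ zero + applyL (λ k → μ (suc k)) p

  module QDefs (q : Carrier) where

    qint : ℕ → Carrier
    qint m = sumTo m (pow q)

    qfact : ℕ → Carrier
    qfact zero    = 1#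
    qfact (suc m) = qfact m · qint (suc m)

    qpoch : Carrier → ℕ → Carrier
    qpoch a zero    = 1#
    qpoch a (suc m) = qpoch a m · (1# - a · pow q m)

    -- (U_{n-1}(1,s,q), U_n(1,s,q)) with U_{-1} = 0, U_0 = 1,
    -- U_n = (1+q^n) U_{n-1} + q^(n-1) s U_{n-2}
    Upair : ℕ → Poly × Poly
    Upair zero    = [] , (1# ∷ [])
    Upair (suc n) =
      proj₂ (Upair n) ,
      (scale (1# + pow q (suc n)) (proj₂ (Upair n))
        ⊕ scale (pow q n) (times-s (proj₁ (Upair n))))

    U : ℕ → Poly
    U n = proj₂ (Upair n)

    row0 : ℕ → Carrier
    row0 (suc zero) = 1#
    row0 _          = 0#

    oddFrom : (ℕ → Carrier) → ℕ → Carrier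
    oddFrom r zero    = 0#
    oddFrom r (suc k) = pow q (2 *ℕ k) · oddFrom r k
                        + (1# + pow q (suc (2 *ℕ k))) · r (suc k)

    -- Even row b(2n,·) (n ≥ 1) from the odd row r = b(2n-1,·), computed
    -- downward: evenAux n r j = b(2n, n+1-j), with b(2n,n+1) = 0 and
    -- b(2n,k) = q^(1-2k) (b(2n,k+1) + (1+q^(2k)) b(2n-1,k)).
    evenAux : ℕ → (ℕ → Carrier) → ℕ → Carrier
    evenAux n r zero    = 0#
    evenAux n r (suc j) =
      (pow q (2 *ℕ (n ∸ j) ∸ 1)) ⁻¹
        · (evenAux n r j + (1# + pow q (2 *ℕ (n ∸ j))) · r (n ∸ j))

    evenFrom : ℕ → (ℕ → Carrier) → ℕ → Carrier
    evenFrom n r zero    = 0#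
    evenFrom n r (suc k) = evenAux n r (n ∸ k)

    evenRow : ℕ → ℕ → Carrier
    evenRow zero    = row0
    evenRow (suc n) = evenFrom (suc n) (oddFrom (evenRow n))

    -- b(n,k,q) for 0 ≤ k ≤ 1 + ⌊n/2⌋ (values outside this range are junk)
    b : ℕ → ℕ → Carrier
    b n with halfParity n
    ... | h , false = evenRow h
    ... | h , true  = oddFrom (evenRow h)

    -- Formal power series in z, given by coefficient sequences.
    -- coefficient of z^j in e(z) + e(-z)
    ePlus : ℕ → Carrier
    ePlus j = (1# + pow (- 1#) j) · (qfact j) ⁻¹

    eMinus : ℕ → Carrier
    eMinus j = (1# - pow (- 1#) j) · (qfact j) ⁻¹

    lhsCoeff : ℕ → Carrier
    lhsCoeff zero    = 0#
    lhsCoeff (suc j) = eMinus j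

    -- coefficient of z^j in Σ_{n≥1} (-1)^(n-1) G_{2n} (-q;q)_{2n-1} z^(2n) / [2n]!,
    -- where G n stands for G_{2n}(q)
    seriesG : (ℕ → Carrier) → ℕ → Carrier
    seriesG G j with halfParity j
    ... | zero , false  = 0#
    ... | suc m , false = pow (- 1#) m · G (suc m) · qpoch (- q) (suc (2 *ℕ m))
                            · (qfact (2 *ℕ suc m)) ⁻¹
    ... | _ , true      = 0#

    rhsCoeff : (ℕ → Carrier) → ℕ → Carrier
    rhsCoeff G j = sumTo (suc j) (λ i → ePlus i · seriesG G (j ∸ i))

    -- G n = G_{2n}(q) (n ≥ 1) is a sequence satisfying the defining identity
    -- z (e(z)-e(-z))/(e(z)+e(-z)) = Σ ..., i.e. (multiplying out) the formal
    -- power series identity z (e(z)-e(-z)) = (e(z)+e(-z)) · Σ ...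
    IsGenocchi : (ℕ → Carrier) → Set ℓ
    IsGenocchi G = ∀ j → lhsCoeff j ≈ rhsCoeff G j

-- The rows of b are signed moments of the polynomials U: b(2n+1,k) is
-- (-1)^n λ(s^(n+1-k) U_{2k-1}) and b(2n,k) is (-1)^n λ(s^(n-k) U_{2k}), because both defining
-- recurrences of b are the three-term recurrence of U; on the diagonal this is the first equality.
-- For the second, expand U_{M-1} = Σ_k [M,2k+1] P_k in q-binomials with P_k = ∏_{i<k} q^(2i+1) (s + q^(2i+2)).
-- Trinomial revision and the symmetry [R,a] = [R,R-a] for odd R make Σ_a (-1)^a [2m,a] U_{2m-a-1} vanish;
-- applying λ, which kills U_{2j} for j > 0, leaves Σ_i [2m,2i] λ(U_{2m-2i-1}) = [2m].  Multiplying out the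
-- defining series, z (e(z) - e(-z)) = (e(z) + e(-z)) Σ ..., shows that (-1)^(j-1) (-q;q)_{2j-1} G_{2j}
-- satisfies the same unitriangular system, so the two sequences agree.
module Submission where

open import Defs
open import Level using (Level)
open import Algebra.Bundles using (CommutativeRing)
open import Algebra.Solver.Ring.AlmostCommutativeRing using (_-Raw-AlmostCommutative⟶_; fromCommutativeRing)
open import Data.Bool using (true; false)
open import Data.Integer as ℤ using (ℤ; +_; -[1+_]; _⊖_)
import Data.Integer.Properties as ℤ
open import Data.List using ([]; _∷_)
open import Data.Maybe as Maybe using (Maybe)
open import Data.Nat using (ℕ; zero; suc; _≤_; _<_; z≤n; s≤s; _∸_) renaming (_*_ to _*ℕ_; _+_ to _+ℕ_)
import Data.Nat as ℕ
import Data.Nat.Properties as ℕ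
open import Data.Nat.Tactic.RingSolver using (solve-∀)
open import Data.Product using (_×_; _,_; proj₁)
open import Data.Sign as Sign using (Sign)
open import Data.Sum using (inj₁; inj₂)
open import Relation.Binary.Definitions using (tri<; tri≈; tri>)
import Relation.Binary.PropositionalEquality as ≡
open ≡ using (_≡_)
open import Relation.Nullary using (¬_; yes; no)
open import Relation.Nullary.Decidable using (dec⇒maybe)

-- The standard library's ring solvers for an arbitrary commutative ring take coefficients in the
-- ring itself, where they cannot decide that x - x is 0; integer coefficients can.
module ℤ-CoefficientSolver {c ℓ : Level} (R : CommutativeRing c ℓ) where
  open CommutativeRing R
  open import Algebra.Properties.Ring ring using (-‿involutive; -0#≈0#; -1*x≈-x; -‿+-comm)
  open import Algebra.Properties.Semiring.Mult.TCOptimised semiring using (1+×; ×-homo-+; ×1-homo-*) renaming (_×_ to _·_)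
  open import Algebra.Properties.CommutativeSemigroup +-commutativeSemigroup using () renaming (interchange to +-interchange)
  open import Algebra.Properties.CommutativeSemigroup *-commutativeSemigroup using () renaming (interchange to *-interchange)
  open import Relation.Binary.Reasoning.Setoid setoid

  ⟦_⟧ℤ : ℤ → Carrier
  ⟦ + n ⟧ℤ      = n · 1#
  ⟦ -[1+ n ] ⟧ℤ = - (suc n · 1#)

  private
    cancel-+ˡ : ∀ x a b → (x + a) - (x + b) ≈ a - b
    cancel-+ˡ x a b = begin
      (x + a) + - (x + b)   ≈⟨ +-congˡ (-‿+-comm x b) ⟨
      (x + a) + (- x + - b) ≈⟨ +-interchange x a (- x) (- b) ⟩
      (x - x) + (a - b)     ≈⟨ +-congʳ (-‿inverseʳ x) ⟩
      0# + (a - b)          ≈⟨ +-identityˡ _ ⟩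
      a - b                 ∎

    ⊖-homo : ∀ m n → ⟦ m ⊖ n ⟧ℤ ≈ m · 1# - n · 1#
    ⊖-homo zero    zero    = sym (-‿inverseʳ 0#)
    ⊖-homo zero    (suc n) = sym (+-identityˡ _)
    ⊖-homo (suc m) zero    = sym (trans (+-congˡ -0#≈0#) (+-identityʳ _))
    ⊖-homo (suc m) (suc n) rewrite ℤ.[1+m]⊖[1+n]≡m⊖n m n = begin
      ⟦ m ⊖ n ⟧ℤ                        ≈⟨ ⊖-homo m n ⟩
      m · 1# - n · 1#                   ≈⟨ cancel-+ˡ 1# _ _ ⟨
      (1# + m · 1#) - (1# + n · 1#)     ≈⟨ +-cong (1+× m 1#) (-‿cong (1+× n 1#)) ⟨
      suc m · 1# - suc n · 1#           ∎

    +-homo : ∀ i j → ⟦ i ℤ.+ j ⟧ℤ ≈ ⟦ i ⟧ℤ + ⟦ j ⟧ℤ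
    +-homo (+ m)    (+ n)    = ×-homo-+ 1# m n
    +-homo (+ m)    -[1+ n ] = ⊖-homo m (suc n)
    +-homo -[1+ m ] (+ n)    = trans (⊖-homo n (suc m)) (+-comm _ _)
    +-homo -[1+ m ] -[1+ n ] = begin
      - (suc (suc m ℕ.+ n) · 1#)          ≈⟨ -‿cong (reflexive (≡.cong (λ k → suc k · 1#) (ℕ.+-suc m n))) ⟨
      - ((suc m ℕ.+ suc n) · 1#)          ≈⟨ -‿cong (×-homo-+ 1# (suc m) (suc n)) ⟩
      - (suc m · 1# + suc n · 1#)         ≈⟨ -‿+-comm _ _ ⟨
      - (suc m · 1#) + - (suc n · 1#)     ∎

    neg-homo : ∀ i → ⟦ ℤ.- i ⟧ℤ ≈ - ⟦ i ⟧ℤ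
    neg-homo (+ zero)  = sym -0#≈0#
    neg-homo (+ suc n) = refl
    neg-homo -[1+ n ]  = sym (-‿involutive _)

    ⟦_⟧ₛ : Sign → Carrier
    ⟦ Sign.+ ⟧ₛ = 1#
    ⟦ Sign.- ⟧ₛ = - 1#

    sign-*-homo : ∀ s t → ⟦ s Sign.* t ⟧ₛ ≈ ⟦ s ⟧ₛ * ⟦ t ⟧ₛ
    sign-*-homo Sign.- Sign.- = sym (trans (-1*x≈-x _) (-‿involutive _))
    sign-*-homo Sign.- Sign.+ = sym (*-identityʳ _)
    sign-*-homo Sign.+ t      = sym (*-identityˡ _)

    ◃-homo : ∀ s n → ⟦ s ℤ.◃ n ⟧ℤ ≈ ⟦ s ⟧ₛ * (n · 1#)
    ◃-homo s      zero    = sym (zeroʳ _)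
    ◃-homo Sign.+ (suc n) = sym (*-identityˡ _)
    ◃-homo Sign.- (suc n) = sym (-1*x≈-x _)

    sign-abs : ∀ i → ⟦ i ⟧ℤ ≈ ⟦ ℤ.sign i ⟧ₛ * (ℤ.∣ i ∣ · 1#)
    sign-abs (+ n)    = sym (*-identityˡ _)
    sign-abs -[1+ n ] = sym (-1*x≈-x _)

    *-homo : ∀ i j → ⟦ i ℤ.* j ⟧ℤ ≈ ⟦ i ⟧ℤ * ⟦ j ⟧ℤ
    *-homo i j = begin
      ⟦ (si Sign.* sj) ℤ.◃ (∣i∣ ℕ.* ∣j∣) ⟧ℤ          ≈⟨ ◃-homo (si Sign.* sj) (∣i∣ ℕ.* ∣j∣) ⟩
      ⟦ si Sign.* sj ⟧ₛ * ((∣i∣ ℕ.* ∣j∣) · 1#)        ≈⟨ *-cong (sign-*-homo si sj) (×1-homo-* ∣i∣ ∣j∣) ⟩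
      (⟦ si ⟧ₛ * ⟦ sj ⟧ₛ) * ((∣i∣ · 1#) * (∣j∣ · 1#)) ≈⟨ *-interchange _ _ _ _ ⟩
      (⟦ si ⟧ₛ * (∣i∣ · 1#)) * (⟦ sj ⟧ₛ * (∣j∣ · 1#)) ≈⟨ *-cong (sign-abs i) (sign-abs j) ⟨
      ⟦ i ⟧ℤ * ⟦ j ⟧ℤ                                ∎
      where
      si = ℤ.sign i
      sj = ℤ.sign j
      ∣i∣ = ℤ.∣ i ∣
      ∣j∣ = ℤ.∣ j ∣

  homomorphism : ℤ.+-*-rawRing -Raw-AlmostCommutative⟶ fromCommutativeRing R
  homomorphism = record
    { ⟦_⟧ = ⟦_⟧ℤ ; +-homo = +-homo ; *-homo = *-homo ; -‿homo = neg-homo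
    ; 0-homo = refl ; 1-homo = refl }

  ⟦_⟧ℤ-≟ : ∀ i j → Maybe (⟦ i ⟧ℤ ≈ ⟦ j ⟧ℤ)
  ⟦ i ⟧ℤ-≟ j = Maybe.map (λ { ≡.refl → refl }) (dec⇒maybe (i ℤ.≟ j))

  open import Algebra.Solver.Ring ℤ.+-*-rawRing (fromCommutativeRing R) homomorphism ⟦_⟧ℤ-≟ public
    using (solve; _:=_; con; _:+_; _:*_; :-_; _:-_)


halfParity-even : ∀ m → halfParity (2 *ℕ m) ≡ (m , false)
halfParity-odd  : ∀ m → halfParity (suc (2 *ℕ m)) ≡ (m , true)
halfParity-even zero    = ≡.refl
halfParity-even (suc m) = ≡.trans (≡.cong halfParity (ℕ.*-suc 2 m)) (after-odd {suc (2 *ℕ m)} (halfParity-odd m))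
  where
  after-odd : ∀ {n h} → halfParity n ≡ (h , true) → halfParity (suc n) ≡ (suc h , false)
  after-odd {n} e with halfParity n | e
  ... | _ | ≡.refl = ≡.refl
halfParity-odd m rewrite halfParity-even m = ≡.refl

2m∸[1+2k]≡1+2[m∸[1+k]] : ∀ m k → suc (2 *ℕ k) ≤ 2 *ℕ m → 2 *ℕ m ∸ suc (2 *ℕ k) ≡ suc (2 *ℕ (m ∸ suc k))
2m∸[1+2k]≡1+2[m∸[1+k]] m k 1+2k≤2m = begin
  2 *ℕ m ∸ suc (2 *ℕ k)                            ≡⟨ ≡.cong (λ n → 2 *ℕ n ∸ suc (2 *ℕ k)) (ℕ.m+[n∸m]≡n k<m) ⟨
  2 *ℕ (suc k +ℕ d) ∸ suc (2 *ℕ k)                 ≡⟨ ≡.cong (_∸ suc (2 *ℕ k)) (double-split k d) ⟩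
  suc (2 *ℕ k) +ℕ suc (2 *ℕ d) ∸ suc (2 *ℕ k)      ≡⟨ ℕ.m+n∸m≡n (suc (2 *ℕ k)) (suc (2 *ℕ d)) ⟩
  suc (2 *ℕ d)                                     ∎
  where
  open ≡.≡-Reasoning
  k<m = ℕ.*-cancelˡ-< 2 k m 1+2k≤2m
  d = m ∸ suc k
  double-split : ∀ k d → 2 *ℕ (suc k +ℕ d) ≡ suc (2 *ℕ k) +ℕ suc (2 *ℕ d)
  double-split = solve-∀

module FieldTheory {c ℓ : Level} (F : Field c ℓ) where
  open Field F
  open FieldDefs F
  open ℤ-CoefficientSolver commutativeRing using (solve; _:=_; con; _:+_; _:*_; :-_; _:-_)
  open import Relation.Binary.Reasoning.Setoid setoid

  inverseˡ : ∀ x → ¬ (x ≈ 0#) → x ⁻¹ * x ≈ 1#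
  inverseˡ x x≉0 = trans (*-comm _ _) (inverse x x≉0)

  x⁻¹*[x*y]≈y : ∀ {x} y → ¬ (x ≈ 0#) → x ⁻¹ * (x * y) ≈ y
  x⁻¹*[x*y]≈y {x} y x≉0 = begin
    x ⁻¹ * (x * y) ≈⟨ *-assoc _ _ _ ⟨
    x ⁻¹ * x * y   ≈⟨ *-congʳ (inverseˡ x x≉0) ⟩
    1# * y         ≈⟨ *-identityˡ y ⟩
    y              ∎

  *-cancelʳ : ∀ {x y z} → ¬ (z ≈ 0#) → x * z ≈ y * z → x ≈ y
  *-cancelʳ {x} {y} {z} z≉0 xz≈yz = begin
    x              ≈⟨ x⁻¹*[x*y]≈y x z≉0 ⟨
    z ⁻¹ * (z * x) ≈⟨ *-congˡ (trans (*-comm z x) (trans xz≈yz (*-comm y z))) ⟩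
    z ⁻¹ * (z * y) ≈⟨ x⁻¹*[x*y]≈y y z≉0 ⟩
    y              ∎

  *-nonzero : ∀ {x y} → ¬ (x ≈ 0#) → ¬ (y ≈ 0#) → ¬ (x * y ≈ 0#)
  *-nonzero {x} {y} x≉0 y≉0 xy≈0 = y≉0 (begin
    y              ≈⟨ x⁻¹*[x*y]≈y y x≉0 ⟨
    x ⁻¹ * (x * y) ≈⟨ *-congˡ xy≈0 ⟩
    x ⁻¹ * 0#      ≈⟨ zeroʳ _ ⟩
    0#             ∎)

  x≈-x⇒x≈0 : ¬ (1# + 1# ≈ 0#) → ∀ {x} → x ≈ - x → x ≈ 0#
  x≈-x⇒x≈0 2≉0 {x} x≈-x = *-cancelʳ 2≉0 (begin
    x * (1# + 1#) ≈⟨ solve 1 (λ x → x :* (con (+ 1) :+ con (+ 1)) := x :+ x) refl x ⟩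
    x + x         ≈⟨ +-congˡ x≈-x ⟩
    x - x         ≈⟨ -‿inverseʳ x ⟩
    0#            ≈⟨ zeroˡ _ ⟨
    0# * (1# + 1#) ∎)

  pow-homo-+ : ∀ x m n → pow x (m +ℕ n) ≈ pow x m * pow x n
  pow-homo-+ x zero    n = sym (*-identityˡ _)
  pow-homo-+ x (suc m) n = trans (*-congˡ (pow-homo-+ x m n)) (sym (*-assoc _ _ _))

  pow-nonzero : ∀ {x} → ¬ (x ≈ 0#) → ∀ n → ¬ (pow x n ≈ 0#)
  pow-nonzero x≉0 zero    1≈0 = 0≉1 (sym 1≈0)
  pow-nonzero x≉0 (suc n)     = *-nonzero x≉0 (pow-nonzero x≉0 n)

  sgn : ℕ → Carrier
  sgn = pow (- 1#)

  sgn*sgn : ∀ a → sgn a * sgn a ≈ 1#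
  sgn*sgn zero    = *-identityˡ _
  sgn*sgn (suc a) = trans (solve 1 (λ s → (:- con (+ 1) :* s) :* (:- con (+ 1) :* s) := s :* s) refl (sgn a)) (sgn*sgn a)

  sgn-even : ∀ r → sgn (2 *ℕ r) ≈ 1#
  sgn-even zero    = refl
  sgn-even (suc r) = begin
    sgn (2 *ℕ suc r)      ≡⟨ ≡.cong sgn (ℕ.*-suc 2 r) ⟩
    - 1# * (- 1# * sgn (2 *ℕ r)) ≈⟨ solve 1 (λ s → :- con (+ 1) :* (:- con (+ 1) :* s) := s) refl _ ⟩
    sgn (2 *ℕ r)          ≈⟨ sgn-even r ⟩
    1#                    ∎

  sgn-odd : ∀ r → sgn (suc (2 *ℕ r)) ≈ - 1#
  sgn-odd r = trans (*-congˡ (sgn-even r)) (*-identityʳ _)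

  sgn-∸ : ∀ R a → a ≤ R → sgn (R ∸ a) ≈ sgn R * sgn a
  sgn-∸ R a a≤R = begin
    sgn (R ∸ a)                 ≈⟨ *-identityʳ _ ⟨
    sgn (R ∸ a) * 1#            ≈⟨ *-congˡ (sgn*sgn a) ⟨
    sgn (R ∸ a) * (sgn a * sgn a) ≈⟨ *-assoc _ _ _ ⟨
    sgn (R ∸ a) * sgn a * sgn a ≈⟨ *-congʳ (pow-homo-+ (- 1#) (R ∸ a) a) ⟨
    sgn (R ∸ a +ℕ a) * sgn a    ≡⟨ ≡.cong (λ n → sgn n * sgn a) (ℕ.m∸n+n≡m a≤R) ⟩
    sgn R * sgn a               ∎

  sumTo-cong : ∀ n {f g : ℕ → Carrier} → (∀ i → i < n → f i ≈ g i) → sumTo n f ≈ sumTo n g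
  sumTo-cong zero    f≈g = refl
  sumTo-cong (suc n) f≈g = +-cong (sumTo-cong n (λ i i<n → f≈g i (ℕ.m<n⇒m<1+n i<n))) (f≈g n ℕ.≤-refl)

  sumTo-≈0 : ∀ n {f : ℕ → Carrier} → (∀ i → i < n → f i ≈ 0#) → sumTo n f ≈ 0#
  sumTo-≈0 zero    f≈0 = refl
  sumTo-≈0 (suc n) f≈0 = trans (+-cong (sumTo-≈0 n (λ i i<n → f≈0 i (ℕ.m<n⇒m<1+n i<n))) (f≈0 n ℕ.≤-refl)) (+-identityˡ _)

  sumTo-+ : ∀ n (f g : ℕ → Carrier) → sumTo n (λ i → f i + g i) ≈ sumTo n f + sumTo n g
  sumTo-+ zero    f g = sym (+-identityˡ _)
  sumTo-+ (suc n) f g = trans (+-congʳ (sumTo-+ n f g))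
    (solve 4 (λ a b c d → (a :+ b) :+ (c :+ d) := (a :+ c) :+ (b :+ d)) refl _ _ _ _)

  sumTo-*ˡ : ∀ n a (f : ℕ → Carrier) → sumTo n (λ i → a * f i) ≈ a * sumTo n f
  sumTo-*ˡ zero    a f = sym (zeroʳ _)
  sumTo-*ˡ (suc n) a f = trans (+-congʳ (sumTo-*ˡ n a f)) (sym (distribˡ _ _ _))

  sumTo-neg : ∀ n (f : ℕ → Carrier) → sumTo n (λ i → - f i) ≈ - sumTo n f
  sumTo-neg zero    f = solve 0 (con (+ 0) := :- con (+ 0)) refl
  sumTo-neg (suc n) f = trans (+-congʳ (sumTo-neg n f)) (solve 2 (λ a b → :- a :+ :- b := :- (a :+ b)) refl _ _)

  sumTo-unfoldˡ : ∀ n (f : ℕ → Carrier) → sumTo (suc n) f ≈ f 0 + sumTo n (λ i → f (suc i))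
  sumTo-unfoldˡ zero    f = trans (+-identityˡ _) (sym (+-identityʳ _))
  sumTo-unfoldˡ (suc n) f = trans (+-congʳ (sumTo-unfoldˡ n f)) (+-assoc _ _ _)

  sumTo-+ℕ : ∀ a b (f : ℕ → Carrier) → sumTo (a +ℕ b) f ≈ sumTo a f + sumTo b (λ i → f (a +ℕ i))
  sumTo-+ℕ a zero    f rewrite ℕ.+-identityʳ a = sym (+-identityʳ _)
  sumTo-+ℕ a (suc b) f rewrite ℕ.+-suc a b = trans (+-congʳ (sumTo-+ℕ a b f)) (+-assoc _ _ _)

  sumTo-vanishing-tail : ∀ n {f : ℕ → Carrier} → (∀ i → n ≤ i → f i ≈ 0#) →
                         ∀ {m} → n ≤ m → sumTo m f ≈ sumTo n f
  sumTo-vanishing-tail n {f} f≈0 {m} n≤m = begin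
    sumTo m f                                  ≡⟨ ≡.cong (λ k → sumTo k f) (ℕ.m+[n∸m]≡n n≤m) ⟨
    sumTo (n +ℕ (m ∸ n)) f                     ≈⟨ sumTo-+ℕ n (m ∸ n) f ⟩
    sumTo n f + sumTo (m ∸ n) (λ i → f (n +ℕ i)) ≈⟨ +-congˡ (sumTo-≈0 (m ∸ n) (λ i _ → f≈0 (n +ℕ i) (ℕ.m≤m+n n i))) ⟩
    sumTo n f + 0#                             ≈⟨ +-identityʳ _ ⟩
    sumTo n f                                  ∎

  sumTo-swap : ∀ m n (h : ℕ → ℕ → Carrier) →
    sumTo m (λ a → sumTo n (h a)) ≈ sumTo n (λ k → sumTo m (λ a → h a k))
  sumTo-swap zero    n h = sym (sumTo-≈0 n (λ _ _ → refl))
  sumTo-swap (suc m) n h = trans (+-congʳ (sumTo-swap m n h)) (sym (sumTo-+ n _ (h m)))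

  sumTo-reverse : ∀ R (f : ℕ → Carrier) → sumTo (suc R) f ≈ sumTo (suc R) (λ a → f (R ∸ a))
  sumTo-reverse zero    f = refl
  sumTo-reverse (suc R) f = begin
    sumTo (suc R) f + f (suc R)                    ≈⟨ +-congʳ (sumTo-reverse R f) ⟩
    sumTo (suc R) (λ a → f (R ∸ a)) + f (suc R)    ≈⟨ +-comm _ _ ⟩
    f (suc R) + sumTo (suc R) (λ a → f (R ∸ a))    ≈⟨ sumTo-unfoldˡ (suc R) (λ a → f (suc R ∸ a)) ⟨
    sumTo (suc (suc R)) (λ a → f (suc R ∸ a))      ∎

  sumTo-pairs : ∀ n (f : ℕ → Carrier) → sumTo (2 *ℕ n) f ≈ sumTo n (λ i → f (2 *ℕ i) + f (suc (2 *ℕ i)))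
  sumTo-pairs zero    f = refl
  sumTo-pairs (suc n) f = begin
    sumTo (2 *ℕ suc n) f                               ≡⟨ ≡.cong (λ k → sumTo k f) (ℕ.*-suc 2 n) ⟩
    sumTo (2 *ℕ n) f + f (2 *ℕ n) + f (suc (2 *ℕ n))   ≈⟨ +-assoc _ _ _ ⟩
    sumTo (2 *ℕ n) f + (f (2 *ℕ n) + f (suc (2 *ℕ n))) ≈⟨ +-congʳ (sumTo-pairs n f) ⟩
    sumTo (suc n) (λ i → f (2 *ℕ i) + f (suc (2 *ℕ i))) ∎

  applyL-cong : ∀ p {ν ν′ : ℕ → Carrier} → (∀ i → ν i ≈ ν′ i) → applyL ν p ≈ applyL ν′ p
  applyL-cong []      ν≈ν′ = refl
  applyL-cong (a ∷ p) ν≈ν′ = +-cong (*-congˡ (ν≈ν′ 0)) (applyL-cong p (λ i → ν≈ν′ (suc i)))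

  applyL-⊕ : ∀ p r ν → applyL ν (p ⊕ r) ≈ applyL ν p + applyL ν r
  applyL-⊕ []      r       ν = sym (+-identityˡ _)
  applyL-⊕ (a ∷ p) []      ν = sym (+-identityʳ _)
  applyL-⊕ (a ∷ p) (b ∷ r) ν = trans (+-congˡ (applyL-⊕ p r (λ k → ν (suc k))))
    (solve 5 (λ a b m x y → (a :+ b) :* m :+ (x :+ y) := (a :* m :+ x) :+ (b :* m :+ y)) refl _ _ _ _ _)

  applyL-scale : ∀ a p ν → applyL ν (scale a p) ≈ a * applyL ν p
  applyL-scale a []      ν = sym (zeroʳ _)
  applyL-scale a (b ∷ p) ν = trans (+-congˡ (applyL-scale a p (λ k → ν (suc k))))
    (solve 4 (λ a b m x → a :* b :* m :+ a :* x := a :* (b :* m :+ x)) refl _ _ _ _)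

  applyL-times-s : ∀ p ν → applyL ν (times-s p) ≈ applyL (λ k → ν (suc k)) p
  applyL-times-s p ν = trans (+-congʳ (zeroˡ _)) (+-identityˡ _)

  module UMoments (q : Carrier) where
    open QDefs q

    -- Uprev M = U_{M-1}(1,s,q), with U_{-1} = 0.
    Uprev : ℕ → Poly
    Uprev M = proj₁ (Upair M)

    ΛUprev : (ℕ → Carrier) → ℕ → Carrier
    ΛUprev ν M = applyL ν (Uprev M)

    ΛUprev-rec : ∀ ν n → ΛUprev ν (suc (suc n)) ≈
                 (1# + pow q (suc n)) * ΛUprev ν (suc n) + pow q n * ΛUprev (λ k → ν (suc k)) n
    ΛUprev-rec ν n = begin
      applyL ν (scale (1# + pow q (suc n)) (U n) ⊕ scale (pow q n) (times-s (Uprev n)))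
        ≈⟨ applyL-⊕ (scale _ (U n)) (scale _ (times-s (Uprev n))) ν ⟩
      applyL ν (scale (1# + pow q (suc n)) (U n)) + applyL ν (scale (pow q n) (times-s (Uprev n)))
        ≈⟨ +-cong (applyL-scale _ (U n) ν) (trans (applyL-scale _ (times-s (Uprev n)) ν) (*-congˡ (applyL-times-s (Uprev n) ν))) ⟩
      (1# + pow q (suc n)) * ΛUprev ν (suc n) + pow q n * ΛUprev (λ k → ν (suc k)) n ∎

  module QBinomial (q : Carrier) ([m+1]≉0 : ∀ m → ¬ (QDefs.qint q (suc m) ≈ 0#)) where
    open QDefs q

    qbinom : ℕ → ℕ → Carrier
    qbinom n       zero    = 1#
    qbinom zero    (suc k) = 0#
    qbinom (suc n) (suc k) = qbinom n k + pow q (suc k) * qbinom n (suc k)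

    qbinom-> : ∀ n k → n < k → qbinom n k ≈ 0#
    qbinom-> zero    (suc k) _           = refl
    qbinom-> (suc n) (suc k) (s≤s n<k) = begin
      qbinom n k + pow q (suc k) * qbinom n (suc k) ≈⟨ +-cong (qbinom-> n k n<k) (*-congˡ (qbinom-> n (suc k) (ℕ.m<n⇒m<1+n n<k))) ⟩
      0# + pow q (suc k) * 0#                     ≈⟨ solve 1 (λ x → con (+ 0) :+ x :* con (+ 0) := con (+ 0)) refl _ ⟩
      0#                                          ∎

    qint-+ : ∀ a b → qint (a +ℕ b) ≈ qint a + pow q a * qint b
    qint-+ a b = trans (sumTo-+ℕ a b (pow q))
      (+-congˡ (trans (sumTo-cong b (λ i _ → pow-homo-+ q a i)) (sumTo-*ˡ b (pow q a) (pow q))))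

    qint-geometric : ∀ m → (1# - q) * qint m ≈ 1# - pow q m
    qint-geometric zero    = solve 1 (λ q → (con (+ 1) :- q) :* con (+ 0) := con (+ 1) :- con (+ 1)) refl q
    qint-geometric (suc m) = begin
      (1# - q) * (qint m + pow q m)          ≈⟨ distribˡ _ _ _ ⟩
      (1# - q) * qint m + (1# - q) * pow q m ≈⟨ +-congʳ (qint-geometric m) ⟩
      1# - pow q m + (1# - q) * pow q m      ≈⟨ solve 2 (λ q p → con (+ 1) :- p :+ (con (+ 1) :- q) :* p := con (+ 1) :- q :* p) refl q (pow q m) ⟩
      1# - pow q (suc m)                     ∎

    qfact-nonzero : ∀ m → ¬ (qfact m ≈ 0#)
    qfact-nonzero zero    1≈0 = 0≉1 (sym 1≈0)
    qfact-nonzero (suc m)     = *-nonzero (qfact-nonzero m) ([m+1]≉0 m)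

    qfact²-nonzero : ∀ a b → ¬ (qfact a * qfact b ≈ 0#)
    qfact²-nonzero a b = *-nonzero (qfact-nonzero a) (qfact-nonzero b)

    qbinom-qfact : ∀ n k → k ≤ n → qbinom n k * (qfact k * qfact (n ∸ k)) ≈ qfact n
    qbinom-qfact n       zero    _         = trans (*-identityˡ _) (*-identityˡ _)
    qbinom-qfact (suc n) (suc k) (s≤s k≤n) with ℕ.m≤n⇒m<n∨m≡n k≤n
    ... | inj₂ ≡.refl = begin
      (qbinom k k + pow q (suc k) * qbinom k (suc k)) * (qfact k * qint (suc k) * qfact (k ∸ k))
        ≈⟨ *-cong (+-congˡ (*-congˡ (qbinom-> k (suc k) ℕ.≤-refl))) (*-congˡ (reflexive (≡.cong qfact (ℕ.n∸n≡0 k)))) ⟩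
      (qbinom k k + pow q (suc k) * 0#) * (qfact k * qint (suc k) * 1#)
        ≈⟨ solve 4 (λ a x f i → (a :+ x :* con (+ 0)) :* (f :* i :* con (+ 1)) := (a :* (f :* con (+ 1))) :* i) refl _ _ _ _ ⟩
      qbinom k k * (qfact k * 1#) * qint (suc k)
        ≈⟨ *-congʳ (trans (*-congˡ (*-congˡ (reflexive (≡.cong qfact (≡.sym (ℕ.n∸n≡0 k)))))) (qbinom-qfact k k ℕ.≤-refl)) ⟩
      qfact k * qint (suc k) ∎
    ... | inj₁ k<n = begin
      (qbinom n k + pow q (suc k) * qbinom n (suc k)) * (qfact k * qint (suc k) * qfact (n ∸ k))
        ≈⟨ *-congˡ (*-congˡ (reflexive (≡.cong qfact n-k))) ⟩
      (qbinom n k + pow q (suc k) * qbinom n (suc k)) * (qfact k * qint (suc k) * (qfact (n ∸ suc k) * qint (suc (n ∸ suc k))))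
        ≈⟨ solve 7 (λ a x b f i g j → (a :+ x :* b) :* (f :* i :* (g :* j)) :=
              a :* (f :* (g :* j)) :* i :+ x :* (b :* (f :* i :* g)) :* j) refl _ _ _ _ _ _ _ ⟩
      qbinom n k * (qfact k * (qfact (n ∸ suc k) * qint (suc (n ∸ suc k)))) * qint (suc k)
        + pow q (suc k) * (qbinom n (suc k) * (qfact k * qint (suc k) * qfact (n ∸ suc k))) * qint (suc (n ∸ suc k))
        ≈⟨ +-cong (*-congʳ (trans (*-congˡ (*-congˡ (reflexive (≡.cong qfact (≡.sym n-k))))) (qbinom-qfact n k k≤n)))
                  (*-congʳ (*-congˡ (qbinom-qfact n (suc k) k<n))) ⟩
      qfact n * qint (suc k) + pow q (suc k) * qfact n * qint (suc (n ∸ suc k))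
        ≈⟨ solve 4 (λ f a x b → f :* a :+ x :* f :* b := f :* (a :+ x :* b)) refl _ _ _ _ ⟩
      qfact n * (qint (suc k) + pow q (suc k) * qint (suc (n ∸ suc k)))
        ≈⟨ *-congˡ (qint-+ (suc k) (suc (n ∸ suc k))) ⟨
      qfact n * qint (suc k +ℕ suc (n ∸ suc k))
        ≡⟨ ≡.cong (λ m → qfact n * qint m) (≡.trans (ℕ.+-suc (suc k) (n ∸ suc k)) (≡.cong suc (ℕ.m+[n∸m]≡n k<n))) ⟩
      qfact n * qint (suc n) ∎
      where
      n-k : n ∸ k ≡ suc (n ∸ suc k)
      n-k = ℕ.+-∸-assoc 1 k<n

    qbinom-sym : ∀ n k → k ≤ n → qbinom n k ≈ qbinom n (n ∸ k)
    qbinom-sym n k k≤n = *-cancelʳ (qfact²-nonzero k (n ∸ k)) (begin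
      qbinom n k * (qfact k * qfact (n ∸ k))                   ≈⟨ qbinom-qfact n k k≤n ⟩
      qfact n                                                  ≈⟨ qbinom-qfact n (n ∸ k) (ℕ.m∸n≤m n k) ⟨
      qbinom n (n ∸ k) * (qfact (n ∸ k) * qfact (n ∸ (n ∸ k))) ≡⟨ ≡.cong (λ m → qbinom n (n ∸ k) * (qfact (n ∸ k) * qfact m)) (ℕ.m∸[m∸n]≡n k≤n) ⟩
      qbinom n (n ∸ k) * (qfact (n ∸ k) * qfact k)             ≈⟨ *-congˡ (*-comm _ _) ⟩
      qbinom n (n ∸ k) * (qfact k * qfact (n ∸ k))             ∎)

    qbinom-ratio : ∀ n k → k < n → qbinom n (suc k) * qint (suc k) ≈ qbinom n k * qint (n ∸ k)
    qbinom-ratio n k k<n = *-cancelʳ (qfact²-nonzero k (n ∸ suc k)) (begin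
      qbinom n (suc k) * qint (suc k) * (qfact k * qfact (n ∸ suc k))
        ≈⟨ solve 4 (λ b i f g → b :* i :* (f :* g) := b :* (f :* i :* g)) refl _ _ _ _ ⟩
      qbinom n (suc k) * (qfact k * qint (suc k) * qfact (n ∸ suc k)) ≈⟨ qbinom-qfact n (suc k) k<n ⟩
      qfact n                                                         ≈⟨ qbinom-qfact n k (ℕ.<⇒≤ k<n) ⟨
      qbinom n k * (qfact k * qfact (n ∸ k))                          ≡⟨ ≡.cong (λ m → qbinom n k * (qfact k * qfact m)) n-k ⟩
      qbinom n k * (qfact k * (qfact (n ∸ suc k) * qint (suc (n ∸ suc k))))
        ≈⟨ solve 4 (λ b f g i → b :* (f :* (g :* i)) := b :* i :* (f :* g)) refl _ _ _ _ ⟩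
      qbinom n k * qint (suc (n ∸ suc k)) * (qfact k * qfact (n ∸ suc k))
        ≡⟨ ≡.cong (λ m → qbinom n k * qint m * (qfact k * qfact (n ∸ suc k))) n-k ⟨
      qbinom n k * qint (n ∸ k) * (qfact k * qfact (n ∸ suc k)) ∎)
      where
      n-k : n ∸ k ≡ suc (n ∸ suc k)
      n-k = ℕ.+-∸-assoc 1 k<n

    qbinom-pascal′ : ∀ n k → qbinom (suc n) (suc k) ≈ pow q (n ∸ k) * qbinom n k + qbinom n (suc k)
    qbinom-pascal′ n k with ℕ.<-cmp k n
    ... | tri< k<n _ _ = begin
      b₀ + x * b₁                                  ≈⟨ solve 4 (λ b₀ b₁ x y → b₀ :+ x :* b₁ := y :* b₀ :+ b₁ :+ (b₀ :* (con (+ 1) :- y) :- b₁ :* (con (+ 1) :- x))) refl b₀ b₁ x y ⟩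
      y * b₀ + b₁ + (b₀ * (1# - y) - b₁ * (1# - x)) ≈⟨ +-congˡ (+-congʳ ratio) ⟨
      y * b₀ + b₁ + (b₁ * (1# - x) - b₁ * (1# - x)) ≈⟨ solve 4 (λ b₀ b₁ x y → y :* b₀ :+ b₁ :+ (b₁ :* (con (+ 1) :- x) :- b₁ :* (con (+ 1) :- x)) := y :* b₀ :+ b₁) refl b₀ b₁ x y ⟩
      y * b₀ + b₁                                  ∎
      where
      b₀ = qbinom n k
      b₁ = qbinom n (suc k)
      x = pow q (suc k)
      y = pow q (n ∸ k)
      ratio : b₁ * (1# - x) ≈ b₀ * (1# - y)
      ratio = begin
        b₁ * (1# - x)                   ≈⟨ *-congˡ (qint-geometric (suc k)) ⟨
        b₁ * ((1# - q) * qint (suc k))  ≈⟨ solve 3 (λ b a i → b :* (a :* i) := a :* (b :* i)) refl b₁ (1# - q) (qint (suc k)) ⟩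
        (1# - q) * (b₁ * qint (suc k))  ≈⟨ *-congˡ (qbinom-ratio n k k<n) ⟩
        (1# - q) * (b₀ * qint (n ∸ k))  ≈⟨ solve 3 (λ b a i → a :* (b :* i) := b :* (a :* i)) refl b₀ (1# - q) (qint (n ∸ k)) ⟩
        b₀ * ((1# - q) * qint (n ∸ k))  ≈⟨ *-congˡ (qint-geometric (n ∸ k)) ⟩
        b₀ * (1# - y)                   ∎
    ... | tri≈ _ ≡.refl _ = begin
      qbinom n n + pow q (suc n) * qbinom n (suc n) ≈⟨ +-congˡ (*-congˡ (qbinom-> n (suc n) ℕ.≤-refl)) ⟩
      qbinom n n + pow q (suc n) * 0#               ≈⟨ solve 2 (λ a x → a :+ x :* con (+ 0) := con (+ 1) :* a :+ con (+ 0)) refl _ _ ⟩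
      1# * qbinom n n + 0#                          ≈⟨ +-cong (*-congʳ (reflexive (≡.cong (pow q) (≡.sym (ℕ.n∸n≡0 n))))) (sym (qbinom-> n (suc n) ℕ.≤-refl)) ⟩
      pow q (n ∸ n) * qbinom n n + qbinom n (suc n) ∎
    ... | tri> _ _ n<k = begin
      qbinom n k + pow q (suc k) * qbinom n (suc k) ≈⟨ +-cong (qbinom-> n k n<k) (*-congˡ (qbinom-> n (suc k) (ℕ.m<n⇒m<1+n n<k))) ⟩
      0# + pow q (suc k) * 0#                       ≈⟨ solve 2 (λ x y → con (+ 0) :+ x :* con (+ 0) := y :* con (+ 0) :+ con (+ 0)) refl _ _ ⟩
      pow q (n ∸ k) * 0# + 0#                       ≈⟨ +-cong (*-congˡ (qbinom-> n k n<k)) (qbinom-> n (suc k) (ℕ.m<n⇒m<1+n n<k)) ⟨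
      pow q (n ∸ k) * qbinom n k + qbinom n (suc k) ∎

    -- q^(M-j) q^j = q^M fails under truncated subtraction only when M < j ≤ K, where [M,K] vanishes.
    pow-∸-qbinom : ∀ M j K → j ≤ K → pow q (M ∸ j) * pow q j * qbinom M K ≈ pow q M * qbinom M K
    pow-∸-qbinom M j K j≤K with K ℕ.≤? M
    ... | yes K≤M = *-congʳ (trans (sym (pow-homo-+ q (M ∸ j) j)) (reflexive (≡.cong (pow q) (ℕ.m∸n+n≡m (ℕ.≤-trans j≤K K≤M)))))
    ... | no  K≰M = trans (*-congˡ [M,K]≈0) (trans (zeroʳ _) (sym (trans (*-congˡ [M,K]≈0) (zeroʳ _))))
      where [M,K]≈0 = qbinom-> M K (ℕ.≰⇒> K≰M)

    qbinom-trinomial : ∀ N a K → a ≤ N → qbinom N a * qbinom (N ∸ a) K ≈ qbinom N K * qbinom (N ∸ K) a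
    qbinom-trinomial N a K a≤N with (a +ℕ K) ℕ.≤? N
    ... | yes a+K≤N = *-cancelʳ Z≉0 (begin
      qbinom N a * qbinom (N ∸ a) K * Z
        ≈⟨ solve 5 (λ x y fa fk fr → x :* y :* (fa :* (fk :* fr)) := x :* (fa :* (y :* (fk :* fr)))) refl _ _ _ _ _ ⟩
      qbinom N a * (qfact a * (qbinom (N ∸ a) K * (qfact K * qfact R)))
        ≈⟨ *-congˡ (*-congˡ (qbinom-qfact (N ∸ a) K K≤N-a)) ⟩
      qbinom N a * (qfact a * qfact (N ∸ a))                       ≈⟨ qbinom-qfact N a a≤N ⟩
      qfact N                                                      ≈⟨ qbinom-qfact N K K≤N ⟨
      qbinom N K * (qfact K * qfact (N ∸ K))                       ≈⟨ *-congˡ (*-congˡ (qbinom-qfact (N ∸ K) a a≤N-K)) ⟨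
      qbinom N K * (qfact K * (qbinom (N ∸ K) a * (qfact a * qfact (N ∸ K ∸ a))))
        ≡⟨ ≡.cong (λ m → qbinom N K * (qfact K * (qbinom (N ∸ K) a * (qfact a * qfact m))))
             (≡.trans (ℕ.∸-+-assoc N K a) (≡.trans (≡.cong (N ∸_) (ℕ.+-comm K a)) (≡.sym (ℕ.∸-+-assoc N a K)))) ⟩
      qbinom N K * (qfact K * (qbinom (N ∸ K) a * (qfact a * qfact R)))
        ≈⟨ solve 5 (λ x y fa fk fr → x :* (fk :* (y :* (fa :* fr))) := x :* y :* (fa :* (fk :* fr))) refl _ _ _ _ _ ⟩
      qbinom N K * qbinom (N ∸ K) a * Z ∎)
      where
      R = N ∸ a ∸ K
      Z = qfact a * (qfact K * qfact R)
      Z≉0 = *-nonzero (qfact-nonzero a) (qfact²-nonzero K R)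
      K≤N : K ≤ N
      K≤N = ℕ.≤-trans (ℕ.m≤n+m K a) a+K≤N
      K≤N-a : K ≤ N ∸ a
      K≤N-a = ℕ.m+n≤o⇒m≤o∸n K (≡.subst (_≤ N) (ℕ.+-comm a K) a+K≤N)
      a≤N-K : a ≤ N ∸ K
      a≤N-K = ℕ.m+n≤o⇒m≤o∸n a a+K≤N
    ... | no a+K≰N with K ℕ.≤? N
    ...   | yes K≤N = trans (*-congˡ (qbinom-> (N ∸ a) K N-a<K)) (trans (zeroʳ _) (sym (trans (*-congˡ (qbinom-> (N ∸ K) a N-K<a)) (zeroʳ _))))
      where
      N<a+K : N < a +ℕ K
      N<a+K = ℕ.≰⇒> a+K≰N
      N-a<K : N ∸ a < K
      N-a<K = ℕ.+-cancelˡ-< a (N ∸ a) K (≡.subst (_< a +ℕ K) (≡.sym (ℕ.m+[n∸m]≡n a≤N)) N<a+K)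
      N-K<a : N ∸ K < a
      N-K<a = ℕ.+-cancelˡ-< K (N ∸ K) a (≡.subst₂ _<_ (≡.sym (ℕ.m+[n∸m]≡n K≤N)) (ℕ.+-comm a K) N<a+K)
    ...   | no K≰N = trans (*-congˡ (qbinom-> (N ∸ a) K (ℕ.≤-<-trans (ℕ.m∸n≤m N a) (ℕ.≰⇒> K≰N))))
                       (trans (zeroʳ _) (sym (trans (*-congʳ (qbinom-> N K (ℕ.≰⇒> K≰N))) (zeroˡ _))))

    qbinom-[n+1,n] : ∀ n → qbinom (suc n) n ≈ qint (suc n)
    qbinom-[n+1,n] n = *-cancelʳ (qfact-nonzero n) (begin
      qbinom (suc n) n * qfact n                    ≈⟨ solve 2 (λ b f → b :* f := b :* (f :* (con (+ 1) :* (con (+ 0) :+ con (+ 1))))) refl _ _ ⟩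
      qbinom (suc n) n * (qfact n * qfact 1)         ≡⟨ ≡.cong (λ m → qbinom (suc n) n * (qfact n * qfact m)) (ℕ.m+n∸n≡m 1 n) ⟨
      qbinom (suc n) n * (qfact n * qfact (suc n ∸ n)) ≈⟨ qbinom-qfact (suc n) n (ℕ.n≤1+n n) ⟩
      qfact n * qint (suc n)                        ≈⟨ *-comm _ _ ⟩
      qint (suc n) * qfact n                        ∎)


    sumTo-qbinom-odd-iv0 : ∀ m → sumTo (suc m) (λ i → qbinom (2 *ℕ suc m) (suc (2 *ℕ i)) * iv0 (m ∸ i)) ≈ qint (2 *ℕ suc m)
    sumTo-qbinom-odd-iv0 m = begin
      sumTo m term + term m
        ≈⟨ +-congʳ (sumTo-≈0 m (λ i i<m → trans (*-congˡ (reflexive (≡.cong iv0 (ℕ.+-∸-assoc 1 i<m)))) (zeroʳ _))) ⟩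
      0# + qbinom N (suc (2 *ℕ m)) * iv0 (m ∸ m)  ≡⟨ ≡.cong (λ k → 0# + qbinom N (suc (2 *ℕ m)) * iv0 k) (ℕ.n∸n≡0 m) ⟩
      0# + qbinom N (suc (2 *ℕ m)) * 1#           ≈⟨ solve 1 (λ x → con (+ 0) :+ x :* con (+ 1) := x) refl _ ⟩
      qbinom N (suc (2 *ℕ m))                     ≡⟨ ≡.cong (λ n → qbinom n (suc (2 *ℕ m))) (ℕ.*-suc 2 m) ⟩
      qbinom (suc (suc (2 *ℕ m))) (suc (2 *ℕ m))  ≈⟨ qbinom-[n+1,n] (suc (2 *ℕ m)) ⟩
      qint (suc (suc (2 *ℕ m)))                   ≡⟨ ≡.cong qint (ℕ.*-suc 2 m) ⟨
      qint N                                      ∎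
      where
      N = 2 *ℕ suc m
      term : ℕ → Carrier
      term i = qbinom N (suc (2 *ℕ i)) * iv0 (m ∸ i)

  module DiagonalOfB (q : Carrier) (q≉0 : ¬ (q ≈ 0#)) (μ : ℕ → Carrier)
                     (μ-U-even : ∀ n → applyL μ (QDefs.U q (2 *ℕ n)) ≈ iv0 n) where
    open QDefs q
    open UMoments q

    -- ΛsU j M = λ(s^j U_{M-1})
    ΛsU : ℕ → ℕ → Carrier
    ΛsU j M = ΛUprev (λ i → μ (j +ℕ i)) M

    ΛsU-rec : ∀ j n → ΛsU j (suc (suc n)) ≈ (1# + pow q (suc n)) * ΛsU j (suc n) + pow q n * ΛsU (suc j) n
    ΛsU-rec j n = trans (ΛUprev-rec _ n)
      (+-congˡ (*-congˡ (applyL-cong (Uprev n) (λ i → reflexive (≡.cong μ (ℕ.+-suc j i))))))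

    -- The intended values of b(2n+1,k) and b(2n,k+1).
    oddRowMoment : ℕ → ℕ → Carrier
    oddRowMoment n k = sgn n * ΛsU (suc n ∸ k) (2 *ℕ k)

    evenRowMoment : ℕ → ℕ → Carrier
    evenRowMoment n zero    = 0#
    evenRowMoment n (suc k) = sgn n * ΛsU (n ∸ k) (suc (2 *ℕ k))

    oddFrom-moments : ∀ n r → (∀ k → k ≤ n → r (suc k) ≈ evenRowMoment n (suc k)) →
                      ∀ k → k ≤ suc n → oddFrom r k ≈ oddRowMoment n k
    oddFrom-moments n r r≈ zero    _         = sym (zeroʳ _)
    oddFrom-moments n r r≈ (suc k) (s≤s k≤n) = begin
      x * oddFrom r k + (1# + y) * r (suc k)
        ≈⟨ +-cong (*-congˡ (oddFrom-moments n r r≈ k (ℕ.m≤n⇒m≤1+n k≤n))) (*-congˡ (r≈ k k≤n)) ⟩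
      x * (sgn n * ΛsU (suc n ∸ k) (2 *ℕ k)) + (1# + y) * (sgn n * ΛsU (n ∸ k) (suc (2 *ℕ k)))
        ≡⟨ ≡.cong (λ j → x * (sgn n * ΛsU j (2 *ℕ k)) + (1# + y) * (sgn n * ΛsU (n ∸ k) (suc (2 *ℕ k)))) (ℕ.+-∸-assoc 1 k≤n) ⟩
      x * (sgn n * ΛsU (suc (n ∸ k)) (2 *ℕ k)) + (1# + y) * (sgn n * ΛsU (n ∸ k) (suc (2 *ℕ k)))
        ≈⟨ solve 5 (λ x s u y v → x :* (s :* u) :+ y :* (s :* v) := s :* (y :* v :+ x :* u)) refl _ _ _ _ _ ⟩
      sgn n * ((1# + y) * ΛsU (n ∸ k) (suc (2 *ℕ k)) + x * ΛsU (suc (n ∸ k)) (2 *ℕ k))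
        ≈⟨ *-congˡ (ΛsU-rec (n ∸ k) (2 *ℕ k)) ⟨
      sgn n * ΛsU (n ∸ k) (suc (suc (2 *ℕ k)))
        ≡⟨ ≡.cong (λ M → sgn n * ΛsU (n ∸ k) M) (ℕ.*-suc 2 k) ⟨
      sgn n * ΛsU (n ∸ k) (2 *ℕ suc k) ∎
      where
      x = pow q (2 *ℕ k)
      y = pow q (suc (2 *ℕ k))

    evenAux-step : ∀ n k → k ≤ n → ∀ {X r} →
      X ≈ sgn (suc n) * ΛsU (n ∸ k) (suc (suc (suc (2 *ℕ k)))) →
      r ≈ sgn n * ΛsU (n ∸ k) (suc (suc (2 *ℕ k))) →
      (pow q (suc (2 *ℕ k))) ⁻¹ * (X + (1# + pow q (suc (suc (2 *ℕ k)))) * r) ≈ evenRowMoment (suc n) (suc k)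
    evenAux-step n k k≤n {X} {r} X≈ r≈ = begin
      x ⁻¹ * (X + (1# + y) * r)
        ≈⟨ *-congˡ (+-cong (trans X≈ (*-congˡ (ΛsU-rec (n ∸ k) (suc (2 *ℕ k))))) (*-congˡ r≈)) ⟩
      x ⁻¹ * ((- 1# * sgn n) * ((1# + y) * u + x * v) + (1# + y) * (sgn n * u))
        ≈⟨ *-congˡ (solve 5 (λ s y u x v → (:- con (+ 1) :* s) :* ((con (+ 1) :+ y) :* u :+ x :* v) :+ (con (+ 1) :+ y) :* (s :* u)
                                          := x :* ((:- con (+ 1) :* s) :* v)) refl _ _ _ _ _) ⟩
      x ⁻¹ * (x * (sgn (suc n) * v)) ≈⟨ x⁻¹*[x*y]≈y _ (pow-nonzero q≉0 (suc (2 *ℕ k))) ⟩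
      sgn (suc n) * v                 ≡⟨ ≡.cong (λ j → sgn (suc n) * ΛsU j (suc (2 *ℕ k))) (ℕ.+-∸-assoc 1 k≤n) ⟨
      evenRowMoment (suc n) (suc k)   ∎
      where
      x = pow q (suc (2 *ℕ k))
      y = pow q (suc (suc (2 *ℕ k)))
      u = ΛsU (n ∸ k) (suc (suc (2 *ℕ k)))
      v = ΛsU (suc (n ∸ k)) (suc (2 *ℕ k))

    evenAux-moments : ∀ n r → (∀ k → k ≤ suc n → r k ≈ oddRowMoment n k) →
                      ∀ j → j ≤ suc n → evenAux (suc n) r j ≈ evenRowMoment (suc n) (suc (suc n ∸ j))
    evenAux-moments n r r≈ zero _ = sym (begin
      sgn (suc n) * ΛsU (n ∸ n) (suc (2 *ℕ suc n)) ≡⟨ ≡.cong (λ j → sgn (suc n) * ΛsU j (suc (2 *ℕ suc n))) (ℕ.n∸n≡0 n) ⟩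
      sgn (suc n) * applyL μ (U (2 *ℕ suc n))      ≈⟨ *-congˡ (μ-U-even (suc n)) ⟩
      sgn (suc n) * 0#                             ≈⟨ zeroʳ _ ⟩
      0#                                           ∎)
    evenAux-moments n r r≈ (suc j) (s≤s j≤n) = begin
      evenAux (suc n) r (suc j)
        ≡⟨ ≡.cong (λ t → (pow q (2 *ℕ t ∸ 1)) ⁻¹ * (evenAux (suc n) r j + (1# + pow q (2 *ℕ t)) * r t)) n+1-j ⟩
      (pow q (2 *ℕ suc k ∸ 1)) ⁻¹ * (evenAux (suc n) r j + (1# + pow q (2 *ℕ suc k)) * r (suc k))
        ≡⟨ ≡.cong (λ t → (pow q (t ∸ 1)) ⁻¹ * (evenAux (suc n) r j + (1# + pow q t) * r (suc k))) (ℕ.*-suc 2 k) ⟩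
      (pow q (suc (2 *ℕ k))) ⁻¹ * (evenAux (suc n) r j + (1# + pow q (suc (suc (2 *ℕ k)))) * r (suc k))
        ≈⟨ evenAux-step n k (ℕ.m∸n≤m n j) previous next ⟩
      evenRowMoment (suc n) (suc k) ∎
      where
      k = n ∸ j
      n+1-j : suc n ∸ j ≡ suc k
      n+1-j = ℕ.+-∸-assoc 1 j≤n
      previous : evenAux (suc n) r j ≈ sgn (suc n) * ΛsU (n ∸ k) (suc (suc (suc (2 *ℕ k))))
      previous = begin
        evenAux (suc n) r j                      ≈⟨ evenAux-moments n r r≈ j (ℕ.m≤n⇒m≤1+n j≤n) ⟩
        evenRowMoment (suc n) (suc (suc n ∸ j))  ≡⟨ ≡.cong (λ t → evenRowMoment (suc n) (suc t)) n+1-j ⟩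
        sgn (suc n) * ΛsU (n ∸ k) (suc (2 *ℕ suc k)) ≡⟨ ≡.cong (λ t → sgn (suc n) * ΛsU (n ∸ k) (suc t)) (ℕ.*-suc 2 k) ⟩
        sgn (suc n) * ΛsU (n ∸ k) (suc (suc (suc (2 *ℕ k)))) ∎
      next : r (suc k) ≈ sgn n * ΛsU (n ∸ k) (suc (suc (2 *ℕ k)))
      next = trans (r≈ (suc k) (s≤s (ℕ.m∸n≤m n j))) (reflexive (≡.cong (λ t → sgn n * ΛsU (n ∸ k) t) (ℕ.*-suc 2 k)))

    evenRow-moments : ∀ n k → k ≤ n → evenRow n (suc k) ≈ evenRowMoment n (suc k)
    evenRow-moments zero    zero _ = sym (trans (*-identityˡ _) (μ-U-even 0))
    evenRow-moments (suc n) k k≤n+1 = begin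
      evenAux (suc n) (oddFrom (evenRow n)) (suc n ∸ k)       ≈⟨ evenAux-moments n _ oddRow-moments (suc n ∸ k) (ℕ.m∸n≤m (suc n) k) ⟩
      evenRowMoment (suc n) (suc (suc n ∸ (suc n ∸ k)))       ≡⟨ ≡.cong (λ t → evenRowMoment (suc n) (suc t)) (ℕ.m∸[m∸n]≡n k≤n+1) ⟩
      evenRowMoment (suc n) (suc k)                           ∎
      where
      oddRow-moments : ∀ k → k ≤ suc n → oddFrom (evenRow n) k ≈ oddRowMoment n k
      oddRow-moments = oddFrom-moments n (evenRow n) (evenRow-moments n)

    b-diagonal : ∀ m → b (2 *ℕ suc m ∸ 1) (suc m) ≈ applyL μ (scale (sgn m) (U (2 *ℕ suc m ∸ 1)))
    b-diagonal m = begin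
      b (2 *ℕ suc m ∸ 1) (suc m)              ≡⟨ ≡.cong (λ n → b n (suc m)) (≡.cong (_∸ 1) (ℕ.*-suc 2 m)) ⟩
      b (suc (2 *ℕ m)) (suc m)                ≡⟨ ≡.cong-app (b-odd m) (suc m) ⟩
      oddFrom (evenRow m) (suc m)             ≈⟨ oddFrom-moments m (evenRow m) (evenRow-moments m) (suc m) ℕ.≤-refl ⟩
      sgn m * ΛsU (m ∸ m) (2 *ℕ suc m)        ≡⟨ ≡.cong (λ j → sgn m * ΛsU j (2 *ℕ suc m)) (ℕ.n∸n≡0 m) ⟩
      sgn m * applyL μ (U (2 *ℕ suc m ∸ 1))   ≈⟨ applyL-scale (sgn m) (U (2 *ℕ suc m ∸ 1)) μ ⟨
      applyL μ (scale (sgn m) (U (2 *ℕ suc m ∸ 1))) ∎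
      where
      b-odd : ∀ m → b (suc (2 *ℕ m)) ≡ oddFrom (evenRow m)
      b-odd m rewrite halfParity-odd m = ≡.refl


  module UExpansion (q : Carrier) ([m+1]≉0 : ∀ m → ¬ (QDefs.qint q (suc m) ≈ 0#)) where
    open QDefs q
    open UMoments q
    open QBinomial q [m+1]≉0

    -- ΛP ν k = λ_ν(P_k) for the polynomial P_k = ∏_{i<k} q^(2i+1) (s + q^(2i+2)).
    ΛP : (ℕ → Carrier) → ℕ → Carrier
    ΛP ν zero    = ν 0
    ΛP ν (suc k) = pow q (suc (2 *ℕ k)) * (ΛP (λ i → ν (suc i)) k + pow q (suc (suc (2 *ℕ k))) * ΛP ν k)

    oddCoeff : ℕ → ℕ → Carrier
    oddCoeff M k = qbinom M (suc (2 *ℕ k))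

    q⁴ᵏ⁺³ : ℕ → Carrier
    q⁴ᵏ⁺³ k = pow q (suc (2 *ℕ k)) * pow q (suc (suc (2 *ℕ k)))

    oddCoeff-rec₀ : ∀ M → oddCoeff (suc (suc M)) 0 ≈
      (1# + pow q (suc M)) * oddCoeff (suc M) 0 - pow q (M ∸ 1) * oddCoeff M 0 * q⁴ᵏ⁺³ 0
    oddCoeff-rec₀ M = begin
      qbinom (suc (suc M)) 1 ≈⟨ qbinom-pascal′ (suc M) 0 ⟩
      q * x * 1# + (1# + (q * 1#) * c₂)
        ≈⟨ solve 3 (λ q x c₂ → q :* x :* con (+ 1) :+ (con (+ 1) :+ (q :* con (+ 1)) :* c₂) :=
              (con (+ 1) :+ q :* x) :* (con (+ 1) :+ (q :* con (+ 1)) :* c₂) :- (q :* (q :* con (+ 1))) :* (x :* c₂)) refl q x c₂ ⟩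
      (1# + q * x) * (1# + (q * 1#) * c₂) - (q * (q * 1#)) * (x * c₂)
        ≈⟨ +-congˡ (-‿cong (*-congˡ (pow-∸-qbinom M 1 1 ℕ.≤-refl))) ⟨
      (1# + q * x) * (1# + (q * 1#) * c₂) - (q * (q * 1#)) * (y * (q * 1#) * c₂)
        ≈⟨ +-congˡ (-‿cong (solve 3 (λ q y c₂ → (q :* (q :* con (+ 1))) :* (y :* (q :* con (+ 1)) :* c₂) :=
              y :* c₂ :* ((q :* con (+ 1)) :* (q :* (q :* con (+ 1))))) refl q y c₂)) ⟩
      (1# + q * x) * (1# + (q * 1#) * c₂) - y * c₂ * q⁴ᵏ⁺³ 0 ∎
      where
      x = pow q M
      y = pow q (M ∸ 1)
      c₂ = qbinom M 1

    qbinom-three-term : ∀ M t → qbinom (suc (suc M)) (3 +ℕ t) ≈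
      (1# + pow q (suc M)) * qbinom (suc M) (3 +ℕ t)
        - pow q (M ∸ (3 +ℕ t)) * qbinom M (3 +ℕ t) * (pow q (3 +ℕ t) * pow q (4 +ℕ t))
        + pow q (M ∸ suc t) * qbinom M (suc t)
    qbinom-three-term M t = begin
      qbinom (suc (suc M)) (3 +ℕ t) ≈⟨ qbinom-pascal′ (suc M) (2 +ℕ t) ⟩
      z′ * (c₁ + (q * p) * c₂) + (c₂ + (q * (q * p)) * c₃)
        ≈⟨ solve 6 (λ z′ c₁ q p c₂ c₃ → z′ :* (c₁ :+ (q :* p) :* c₂) :+ (c₂ :+ (q :* (q :* p)) :* c₃) :=
              z′ :* c₁ :+ q :* (z′ :* p :* c₂) :+ c₂ :+ q :* (q :* p) :* c₃) refl z′ c₁ q p c₂ c₃ ⟩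
      z′ * c₁ + q * (z′ * p * c₂) + c₂ + q * (q * p) * c₃
        ≈⟨ +-congʳ (+-congʳ (+-congˡ (*-congˡ (pow-∸-qbinom M (suc t) (2 +ℕ t) (ℕ.n≤1+n _))))) ⟩
      z′ * c₁ + q * (x * c₂) + c₂ + q * (q * p) * c₃
        ≈⟨ solve 7 (λ z′ c₁ q p c₂ c₃ x → z′ :* c₁ :+ q :* (x :* c₂) :+ c₂ :+ q :* (q :* p) :* c₃ :=
              (con (+ 1) :+ q :* x) :* (c₂ :+ (q :* (q :* p)) :* c₃) :- (q :* (q :* (q :* p))) :* (x :* c₃) :+ z′ :* c₁) refl z′ c₁ q p c₂ c₃ x ⟩
      (1# + q * x) * (c₂ + (q * (q * p)) * c₃) - (q * (q * (q * p))) * (x * c₃) + z′ * c₁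
        ≈⟨ +-congʳ (+-congˡ (-‿cong (*-congˡ (pow-∸-qbinom M (3 +ℕ t) (3 +ℕ t) ℕ.≤-refl)))) ⟨
      (1# + q * x) * (c₂ + (q * (q * p)) * c₃) - (q * (q * (q * p))) * (z * (q * (q * p)) * c₃) + z′ * c₁
        ≈⟨ +-congʳ (+-congˡ (-‿cong (solve 4 (λ q p z c₃ → (q :* (q :* (q :* p))) :* (z :* (q :* (q :* p)) :* c₃) :=
              z :* c₃ :* ((q :* (q :* p)) :* (q :* (q :* (q :* p))))) refl q p z c₃))) ⟩
      (1# + q * x) * (c₂ + (q * (q * p)) * c₃) - z * c₃ * ((q * (q * p)) * (q * (q * (q * p)))) + z′ * c₁ ∎
      where
      x = pow q M
      z′ = pow q (M ∸ suc t)
      z = pow q (M ∸ (3 +ℕ t))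
      p = pow q (suc t)
      c₁ = qbinom M (suc t)
      c₂ = qbinom M (2 +ℕ t)
      c₃ = qbinom M (3 +ℕ t)

    oddCoeff-rec : ∀ M k → oddCoeff (suc (suc M)) (suc k) ≈
      (1# + pow q (suc M)) * oddCoeff (suc M) (suc k)
        - pow q (M ∸ suc (2 *ℕ suc k)) * oddCoeff M (suc k) * q⁴ᵏ⁺³ (suc k)
        + pow q (M ∸ suc (2 *ℕ k)) * oddCoeff M k
    oddCoeff-rec M k = ≡.subst (λ t → qbinom (suc (suc M)) (suc t) ≈ (1# + pow q (suc M)) * qbinom (suc M) (suc t)
        - pow q (M ∸ suc t) * qbinom M (suc t) * (pow q (suc t) * pow q (suc (suc t))) + pow q (M ∸ suc (2 *ℕ k)) * oddCoeff M k)
      (≡.sym (ℕ.*-suc 2 k)) (qbinom-three-term M (2 *ℕ k))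

    -- Termwise form of U_{M+1} = (1+q^(M+1)) U_M + q^M s U_{M-1}: X comes from the first summand, Y and Z from the second.
    module ExpansionStep (ν : ℕ → Carrier) (M : ℕ) where
      ν′ : ℕ → Carrier
      ν′ i = ν (suc i)
      X Y Z Y′ : ℕ → Carrier
      X k = (1# + pow q (suc M)) * (oddCoeff (suc M) k * ΛP ν k)
      Y k = pow q (M ∸ suc (2 *ℕ k)) * oddCoeff M k * ΛP ν (suc k)
      Z k = - (pow q (M ∸ suc (2 *ℕ k)) * oddCoeff M k * q⁴ᵏ⁺³ k * ΛP ν k)
      Y′ zero    = 0#
      Y′ (suc k) = Y k

      -- s P_k = q^(-2k-1) P_{k+1} - q^(2k+2) P_k
      s-times-P : ∀ k → pow q M * (oddCoeff M k * ΛP ν′ k) ≈ Y k + Z k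
      s-times-P k = begin
        pow q M * (oddCoeff M k * ΛP ν′ k)       ≈⟨ *-assoc _ _ _ ⟨
        pow q M * oddCoeff M k * ΛP ν′ k         ≈⟨ *-congʳ (pow-∸-qbinom M (suc (2 *ℕ k)) (suc (2 *ℕ k)) ℕ.≤-refl) ⟨
        z * x * oddCoeff M k * ΛP ν′ k
          ≈⟨ solve 6 (λ z x c p y r → z :* x :* c :* p := z :* c :* (x :* (p :+ y :* r)) :+ :- (z :* c :* (x :* y) :* r))
               refl z x (oddCoeff M k) (ΛP ν′ k) (pow q (suc (suc (2 *ℕ k)))) (ΛP ν k) ⟩
        Y k + Z k                                ∎
        where
        z = pow q (M ∸ suc (2 *ℕ k))
        x = pow q (suc (2 *ℕ k))

      term-rec : ∀ k → oddCoeff (suc (suc M)) k * ΛP ν k ≈ X k + Z k + Y′ k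
      term-rec zero = trans (*-congʳ (oddCoeff-rec₀ M))
        (solve 6 (λ x c₁ z c h p → (x :* c₁ :- z :* c :* h) :* p := x :* (c₁ :* p) :+ :- (z :* c :* h :* p) :+ con (+ 0)) refl _ _ _ _ _ (ΛP ν 0))
      term-rec (suc k) = trans (*-congʳ (oddCoeff-rec M k))
        (solve 8 (λ x c₁ z c h z′ c₀ p → (x :* c₁ :- z :* c :* h :+ z′ :* c₀) :* p := x :* (c₁ :* p) :+ :- (z :* c :* h :* p) :+ z′ :* c₀ :* p) refl _ _ _ _ _ _ _ (ΛP ν (suc k)))

    ΛUprev-expansion : ∀ M ν L → M ≤ L → ΛUprev ν M ≈ sumTo L (λ k → oddCoeff M k * ΛP ν k)
    ΛUprev-expansion zero ν L _ = sym (sumTo-≈0 L (λ _ _ → zeroˡ _))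
    ΛUprev-expansion (suc zero) ν (suc L) _ = begin
      1# * ν 0 + 0#                                 ≈⟨ solve 2 (λ q v → con (+ 1) :* v :+ con (+ 0) := con (+ 0) :+ (con (+ 1) :+ (q :* con (+ 1)) :* con (+ 0)) :* v) refl q (ν 0) ⟩
      0# + (1# + (q * 1#) * 0#) * ν 0              ≈⟨ sumTo-vanishing-tail 1 [1,2k+3]≈0 {suc L} (s≤s z≤n) ⟨
      sumTo (suc L) (λ k → oddCoeff 1 k * ΛP ν k)  ∎
      where
      [1,2k+3]≈0 : ∀ k → 1 ≤ k → oddCoeff 1 k * ΛP ν k ≈ 0#
      [1,2k+3]≈0 (suc k) _ = trans (*-congʳ (qbinom-> 1 (suc (2 *ℕ suc k)) (s≤s (s≤s z≤n)))) (zeroˡ _)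
    ΛUprev-expansion (suc (suc M)) ν (suc L′) (s≤s M+1≤L′) = begin
      ΛUprev ν (suc (suc M))                          ≈⟨ ΛUprev-rec ν M ⟩
      (1# + pow q (suc M)) * ΛUprev ν (suc M) + pow q M * ΛUprev ν′ M
        ≈⟨ +-cong (*-congˡ (ΛUprev-expansion (suc M) ν L (ℕ.m≤n⇒m≤1+n M+1≤L′)))
                  (*-congˡ (ΛUprev-expansion M ν′ L (ℕ.m≤n⇒m≤1+n (ℕ.<⇒≤ M+1≤L′)))) ⟩
      (1# + pow q (suc M)) * sumTo L (λ k → oddCoeff (suc M) k * ΛP ν k) + pow q M * sumTo L (λ k → oddCoeff M k * ΛP ν′ k)
        ≈⟨ +-cong (sumTo-*ˡ L _ _) (sumTo-*ˡ L _ _) ⟨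
      sumTo L X + sumTo L (λ k → pow q M * (oddCoeff M k * ΛP ν′ k))
        ≈⟨ +-congˡ (trans (sumTo-cong L (λ k _ → s-times-P k)) (sumTo-+ L Y Z)) ⟩
      sumTo L X + ((sumTo L′ Y + Y L′) + sumTo L Z)   ≈⟨ +-congˡ (+-congʳ (+-congˡ top-vanishes)) ⟩
      sumTo L X + ((sumTo L′ Y + 0#) + sumTo L Z)
        ≈⟨ solve 3 (λ a b c → a :+ ((b :+ con (+ 0)) :+ c) := a :+ c :+ (con (+ 0) :+ b)) refl _ _ _ ⟩
      sumTo L X + sumTo L Z + (0# + sumTo L′ Y)       ≈⟨ +-congˡ (sumTo-unfoldˡ L′ Y′) ⟨
      sumTo L X + sumTo L Z + sumTo L Y′              ≈⟨ +-congʳ (sumTo-+ L X Z) ⟨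
      sumTo L (λ k → X k + Z k) + sumTo L Y′          ≈⟨ sumTo-+ L _ Y′ ⟨
      sumTo L (λ k → X k + Z k + Y′ k)                ≈⟨ sumTo-cong L (λ k _ → term-rec k) ⟨
      sumTo L (λ k → oddCoeff (suc (suc M)) k * ΛP ν k) ∎
      where
      L = suc L′
      open ExpansionStep ν M
      top-vanishes : Y L′ ≈ 0#
      top-vanishes = trans (*-congʳ (trans (*-congˡ (qbinom-> M (suc (2 *ℕ L′)) M<2L′+1)) (zeroʳ _))) (zeroˡ _)
        where
        M<2L′+1 : M < suc (2 *ℕ L′)
        M<2L′+1 = s≤s (ℕ.≤-trans (ℕ.<⇒≤ M+1≤L′) (ℕ.m≤m+n L′ (L′ +ℕ 0)))

  module AlternatingSums (q : Carrier) ([m+1]≉0 : ∀ m → ¬ (QDefs.qint q (suc m) ≈ 0#))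
                         (2≉0 : ¬ (1# + 1# ≈ 0#)) where
    open QDefs q
    open UMoments q
    open QBinomial q [m+1]≉0
    open UExpansion q [m+1]≉0

    alternating-qbinom-odd : ∀ r → sumTo (suc (suc (2 *ℕ r))) (λ a → sgn a * qbinom (suc (2 *ℕ r)) a) ≈ 0#
    alternating-qbinom-odd r = x≈-x⇒x≈0 2≉0 (begin
      sumTo (suc R) f                 ≈⟨ sumTo-reverse R f ⟩
      sumTo (suc R) (λ a → f (R ∸ a)) ≈⟨ sumTo-cong (suc R) (λ a a<R+1 → reflected a (ℕ.≤-pred a<R+1)) ⟩
      sumTo (suc R) (λ a → - f a)     ≈⟨ sumTo-neg (suc R) f ⟩
      - sumTo (suc R) f               ∎)
      where
      R = suc (2 *ℕ r)
      f : ℕ → Carrier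
      f a = sgn a * qbinom R a
      reflected : ∀ a → a ≤ R → f (R ∸ a) ≈ - f a
      reflected a a≤R = begin
        sgn (R ∸ a) * qbinom R (R ∸ a) ≈⟨ *-cong (trans (sgn-∸ R a a≤R) (*-congʳ (sgn-odd r))) (sym (qbinom-sym R a a≤R)) ⟩
        - 1# * sgn a * qbinom R a      ≈⟨ solve 2 (λ s b → :- con (+ 1) :* s :* b := :- (s :* b)) refl (sgn a) (qbinom R a) ⟩
        - f a                          ∎

    alternating-trinomial : ∀ m k x → sumTo (suc (2 *ℕ m)) (λ a → sgn a * qbinom (2 *ℕ m) a * (oddCoeff (2 *ℕ m ∸ a) k * x)) ≈ 0#
    alternating-trinomial m k x = begin
      sumTo (suc N) (λ a → sgn a * qbinom N a * (qbinom (N ∸ a) K * x))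
        ≈⟨ sumTo-cong (suc N) (λ a a≤N → revise a (ℕ.≤-pred a≤N)) ⟩
      sumTo (suc N) (λ a → (qbinom N K * x) * (sgn a * qbinom (N ∸ K) a)) ≈⟨ sumTo-*ˡ (suc N) _ _ ⟩
      (qbinom N K * x) * sumTo (suc N) (λ a → sgn a * qbinom (N ∸ K) a) ≈⟨ vanishes ⟩
      0# ∎
      where
      N = 2 *ℕ m
      K = suc (2 *ℕ k)
      revise : ∀ a → a ≤ N → sgn a * qbinom N a * (qbinom (N ∸ a) K * x) ≈ (qbinom N K * x) * (sgn a * qbinom (N ∸ K) a)
      revise a a≤N = begin
        sgn a * qbinom N a * (qbinom (N ∸ a) K * x)   ≈⟨ solve 4 (λ s u v x → s :* u :* (v :* x) := x :* (s :* (u :* v))) refl _ _ _ x ⟩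
        x * (sgn a * (qbinom N a * qbinom (N ∸ a) K)) ≈⟨ *-congˡ (*-congˡ (qbinom-trinomial N a K a≤N)) ⟩
        x * (sgn a * (qbinom N K * qbinom (N ∸ K) a)) ≈⟨ solve 4 (λ s u v x → x :* (s :* (u :* v)) := (u :* x) :* (s :* v)) refl _ _ _ x ⟩
        (qbinom N K * x) * (sgn a * qbinom (N ∸ K) a) ∎
      vanishes : (qbinom N K * x) * sumTo (suc N) (λ a → sgn a * qbinom (N ∸ K) a) ≈ 0#
      vanishes with K ℕ.≤? N
      ... | no  K≰N = trans (*-congʳ (trans (*-congʳ (qbinom-> N K (ℕ.≰⇒> K≰N))) (zeroˡ _))) (zeroˡ _)
      ... | yes K≤N = trans (*-congˡ (begin
        sumTo (suc N) g             ≈⟨ sumTo-vanishing-tail (suc (N ∸ K)) (λ a N-K<a → trans (*-congˡ (qbinom-> (N ∸ K) a N-K<a)) (zeroʳ _))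
                                                             {suc N} (s≤s (ℕ.m∸n≤m N K)) ⟩
        sumTo (suc (N ∸ K)) g       ≡⟨ ≡.cong (λ R → sumTo (suc R) (λ a → sgn a * qbinom R a)) (2m∸[1+2k]≡1+2[m∸[1+k]] m k K≤N) ⟩
        sumTo (suc (suc (2 *ℕ (m ∸ suc k)))) (λ a → sgn a * qbinom (suc (2 *ℕ (m ∸ suc k))) a)
                                    ≈⟨ alternating-qbinom-odd (m ∸ suc k) ⟩
        0#                          ∎)) (zeroʳ _)
        where
        g : ℕ → Carrier
        g a = sgn a * qbinom (N ∸ K) a

    alternating-ΛUprev : ∀ m ν → sumTo (suc (2 *ℕ m)) (λ a → sgn a * qbinom (2 *ℕ m) a * ΛUprev ν (2 *ℕ m ∸ a)) ≈ 0#
    alternating-ΛUprev m ν = begin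
      sumTo (suc N) (λ a → sgn a * qbinom N a * ΛUprev ν (N ∸ a))
        ≈⟨ sumTo-cong (suc N) (λ a _ → trans (*-congˡ (ΛUprev-expansion (N ∸ a) ν N (ℕ.m∸n≤m N a))) (sym (sumTo-*ˡ N _ _))) ⟩
      sumTo (suc N) (λ a → sumTo N (λ k → sgn a * qbinom N a * (oddCoeff (N ∸ a) k * ΛP ν k)))
        ≈⟨ sumTo-swap (suc N) N _ ⟩
      sumTo N (λ k → sumTo (suc N) (λ a → sgn a * qbinom N a * (oddCoeff (N ∸ a) k * ΛP ν k)))
        ≈⟨ sumTo-≈0 N (λ k _ → alternating-trinomial m k (ΛP ν k)) ⟩
      0# ∎
      where N = 2 *ℕ m

  module GenocchiMoments (q : Carrier) ([m+1]≉0 : ∀ m → ¬ (QDefs.qint q (suc m) ≈ 0#)) (2≉0 : ¬ (1# + 1# ≈ 0#))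
                         (μ : ℕ → Carrier) (μ-U-even : ∀ n → applyL μ (QDefs.U q (2 *ℕ n)) ≈ iv0 n)
                         (G : ℕ → Carrier) (G-genocchi : QDefs.IsGenocchi q G) where
    open QDefs q
    open UMoments q
    open QBinomial q [m+1]≉0
    open AlternatingSums q [m+1]≉0 2≉0

    -- Both λ(U_{2j-1}) and the Genocchi numbers solve the unitriangular system
    -- evenConvolution X m ≈ [2m+2] (for m ≥ 0), which determines X 1, X 2, ... .
    evenConvolution : (ℕ → Carrier) → ℕ → Carrier
    evenConvolution X m = sumTo (suc m) (λ i → qbinom (2 *ℕ suc m) (2 *ℕ i) * X (suc m ∸ i))

    evenConvolution-injective : ∀ {X Y} → (∀ m → evenConvolution X m ≈ evenConvolution Y m) → ∀ j → X (suc j) ≈ Y (suc j)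
    evenConvolution-injective {X} {Y} X≈Y j = below j j ℕ.≤-refl
      where
      below : ∀ n j → j ≤ n → X (suc j) ≈ Y (suc j)
      below zero zero _ = begin
        X 1                ≈⟨ solve 1 (λ x → x := con (+ 0) :+ con (+ 1) :* x) refl _ ⟩
        0# + 1# * X 1      ≈⟨ X≈Y 0 ⟩
        0# + 1# * Y 1      ≈⟨ solve 1 (λ x → con (+ 0) :+ con (+ 1) :* x := x) refl _ ⟩
        Y 1                ∎
      below (suc n) j j≤n+1 with ℕ.m≤n⇒m<n∨m≡n j≤n+1
      ... | inj₁ j<n+1 = below n j (ℕ.≤-pred j<n+1)
      ... | inj₂ ≡.refl = begin
        X (2 +ℕ n)                           ≈⟨ solve 2 (λ x r → x := con (+ 1) :* x :+ r :- r) refl _ RX ⟩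
        1# * X (2 +ℕ n) + RX - RX            ≈⟨ +-congʳ (trans (sym (sumTo-unfoldˡ (suc n) _)) (trans (X≈Y (suc n)) (sumTo-unfoldˡ (suc n) _))) ⟩
        1# * Y (2 +ℕ n) + RY - RX            ≈⟨ +-congʳ (+-congˡ (sumTo-cong (suc n) lower)) ⟨
        1# * Y (2 +ℕ n) + RX - RX            ≈⟨ solve 2 (λ x r → con (+ 1) :* x :+ r :- r := x) refl _ RX ⟩
        Y (2 +ℕ n)                           ∎
        where
        N = 2 *ℕ suc (suc n)
        RX = sumTo (suc n) (λ i → qbinom N (2 *ℕ suc i) * X (suc n ∸ i))
        RY = sumTo (suc n) (λ i → qbinom N (2 *ℕ suc i) * Y (suc n ∸ i))
        lower : ∀ i → i < suc n → qbinom N (2 *ℕ suc i) * X (suc n ∸ i) ≈ qbinom N (2 *ℕ suc i) * Y (suc n ∸ i)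
        lower i i≤n = *-congˡ (≡.subst (λ t → X t ≈ Y t) (≡.sym (ℕ.+-∸-assoc 1 (ℕ.≤-pred i≤n))) (below n (n ∸ i) (ℕ.m∸n≤m n i)))

    evenConvolution-ΛUprev : ∀ m → evenConvolution (λ j → ΛUprev μ (2 *ℕ j)) m ≈ qint (2 *ℕ suc m)
    evenConvolution-ΛUprev m′ = begin
      Σeven                    ≈⟨ solve 2 (λ a b → a := a :- b :+ b) refl Σeven Σodd ⟩
      Σeven - Σodd + Σodd      ≈⟨ +-congʳ even-odd ⟩
      0# + Σodd                ≈⟨ +-identityˡ _ ⟩
      Σodd                     ≈⟨ sumTo-qbinom-odd-iv0 m′ ⟩
      qint (2 *ℕ suc m′)       ∎
      where
      m = suc m′
      N = 2 *ℕ m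
      f : ℕ → Carrier
      f a = sgn a * qbinom N a * ΛUprev μ (N ∸ a)
      oddTerm : ℕ → Carrier
      oddTerm i = qbinom N (suc (2 *ℕ i)) * iv0 (m ∸ suc i)
      Σeven = evenConvolution (λ j → ΛUprev μ (2 *ℕ j)) m′
      Σodd = sumTo m oddTerm

      f-even : ∀ i → f (2 *ℕ i) ≈ qbinom N (2 *ℕ i) * ΛUprev μ (2 *ℕ (m ∸ i))
      f-even i = trans (*-congʳ (trans (*-congʳ (sgn-even i)) (*-identityˡ _)))
                       (*-congˡ (reflexive (≡.cong (ΛUprev μ) (≡.sym (ℕ.*-distribˡ-∸ 2 m i)))))

      f-odd : ∀ i → i < m → f (suc (2 *ℕ i)) ≈ - oddTerm i
      f-odd i i<m = begin
        sgn (suc (2 *ℕ i)) * qbinom N (suc (2 *ℕ i)) * ΛUprev μ (N ∸ suc (2 *ℕ i))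
          ≈⟨ *-cong (*-congʳ (sgn-odd i)) (reflexive (≡.cong (ΛUprev μ) (2m∸[1+2k]≡1+2[m∸[1+k]] m i 1+2i≤2m))) ⟩
        - 1# * qbinom N (suc (2 *ℕ i)) * applyL μ (U (2 *ℕ (m ∸ suc i))) ≈⟨ *-congˡ (μ-U-even (m ∸ suc i)) ⟩
        - 1# * qbinom N (suc (2 *ℕ i)) * iv0 (m ∸ suc i) ≈⟨ solve 2 (λ x y → :- con (+ 1) :* x :* y := :- (x :* y)) refl _ _ ⟩
        - oddTerm i ∎
        where
        1+2i≤2m : suc (2 *ℕ i) ≤ N
        1+2i≤2m = ℕ.≤-trans (ℕ.n≤1+n _) (≡.subst (_≤ N) (ℕ.*-suc 2 i) (ℕ.*-monoʳ-≤ 2 i<m))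

      even-odd : Σeven - Σodd ≈ 0#
      even-odd = begin
        Σeven - Σodd                                          ≈⟨ +-congˡ (sumTo-neg m oddTerm) ⟨
        Σeven + sumTo m (λ i → - oddTerm i)                   ≈⟨ sumTo-+ m _ _ ⟨
        sumTo m (λ i → qbinom N (2 *ℕ i) * ΛUprev μ (2 *ℕ (m ∸ i)) + - oddTerm i) ≈⟨ sumTo-cong m (λ i i<m → +-cong (f-even i) (f-odd i i<m)) ⟨
        sumTo m (λ i → f (2 *ℕ i) + f (suc (2 *ℕ i)))         ≈⟨ sumTo-pairs m f ⟨
        sumTo N f                                             ≈⟨ +-identityʳ _ ⟨
        sumTo N f + 0#                                        ≈⟨ +-congˡ (trans (*-congˡ (reflexive (≡.cong (ΛUprev μ) (ℕ.n∸n≡0 N)))) (zeroʳ _)) ⟨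
        sumTo (suc N) f                                       ≈⟨ alternating-ΛUprev m μ ⟩
        0#                                                    ∎

    -- genocchiTerm j = (-1)^(j-1) (-q;q)_{2j-1} G_{2j}, i.e. [2j]! times the z^(2j)-coefficient of the defining series.
    genocchiTerm : ℕ → Carrier
    genocchiTerm zero    = 0#
    genocchiTerm (suc t) = sgn t * G (suc t) * qpoch (- q) (suc (2 *ℕ t))

    seriesG-even : ∀ t → seriesG G (2 *ℕ suc t) ≡ genocchiTerm (suc t) * (qfact (2 *ℕ suc t)) ⁻¹
    seriesG-even t = seriesG-at {2 *ℕ suc t} (halfParity-even (suc t))
      where
      seriesG-at : ∀ {j} → halfParity j ≡ (suc t , false) → seriesG G j ≡ genocchiTerm (suc t) * (qfact (2 *ℕ suc t)) ⁻¹
      seriesG-at {j} e with halfParity j | e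
      ... | _ | ≡.refl = ≡.refl

    lhsCoeff-even : ∀ m → lhsCoeff (2 *ℕ suc m) * qfact (2 *ℕ suc m) ≈ (1# + 1#) * qint (2 *ℕ suc m)
    lhsCoeff-even m = ≡.subst (λ n → lhsCoeff n * qfact n ≈ (1# + 1#) * qint n) (≡.sym (ℕ.*-suc 2 m)) (begin
      (1# - sgn (suc t)) * (qfact (suc t)) ⁻¹ * (qfact (suc t) * qint (suc (suc t)))
        ≈⟨ *-congʳ (*-congʳ (+-congˡ (-‿cong (sgn-odd m)))) ⟩
      (1# - - 1#) * (qfact (suc t)) ⁻¹ * (qfact (suc t) * qint (suc (suc t)))
        ≈⟨ solve 3 (λ i f x → (con (+ 1) :- :- con (+ 1)) :* i :* (f :* x) := (con (+ 1) :+ con (+ 1)) :* x :* (i :* f)) refl _ _ _ ⟩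
      (1# + 1#) * qint (suc (suc t)) * ((qfact (suc t)) ⁻¹ * qfact (suc t)) ≈⟨ *-congˡ (inverseˡ _ (qfact-nonzero (suc t))) ⟩
      (1# + 1#) * qint (suc (suc t)) * 1#                                     ≈⟨ *-identityʳ _ ⟩
      (1# + 1#) * qint (suc (suc t))                                          ∎)
      where t = 2 *ℕ m

    ePlus-odd : ∀ i → ePlus (suc (2 *ℕ i)) ≈ 0#
    ePlus-odd i = trans (*-congʳ (+-congˡ (sgn-odd i))) (solve 1 (λ a → (con (+ 1) :+ :- con (+ 1)) :* a := con (+ 0)) refl _)

    rhsCoeff-even-term : ∀ m i → i ≤ m → ePlus (2 *ℕ i) * seriesG G (2 *ℕ suc m ∸ 2 *ℕ i) * qfact (2 *ℕ suc m) ≈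
                                (1# + 1#) * (qbinom (2 *ℕ suc m) (2 *ℕ i) * genocchiTerm (suc m ∸ i))
    rhsCoeff-even-term m i i≤m = begin
      (1# + sgn (2 *ℕ i)) * a⁻¹ * seriesG G (N ∸ 2 *ℕ i) * N!
        ≈⟨ *-cong (*-cong (*-congʳ (+-congˡ (sgn-even i)))
                          (reflexive (≡.trans (≡.cong (seriesG G) N-2i) (seriesG-even t))))
                  (sym (qbinom-qfact N (2 *ℕ i) (ℕ.*-monoʳ-≤ 2 (ℕ.m≤n⇒m≤1+n i≤m)))) ⟩
      (1# + 1#) * a⁻¹ * (genocchiTerm (suc t) * b⁻¹) * (qbinom N (2 *ℕ i) * (qfact (2 *ℕ i) * qfact (N ∸ 2 *ℕ i)))
        ≡⟨ ≡.cong (λ n → (1# + 1#) * a⁻¹ * (genocchiTerm (suc t) * b⁻¹) * (qbinom N (2 *ℕ i) * (qfact (2 *ℕ i) * qfact n)))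
                  N-2i ⟩
      (1# + 1#) * a⁻¹ * (genocchiTerm (suc t) * b⁻¹) * (qbinom N (2 *ℕ i) * (qfact (2 *ℕ i) * qfact (2 *ℕ suc t)))
        ≈⟨ solve 7 (λ w a y b x f g → w :* a :* (y :* b) :* (x :* (f :* g)) := w :* (x :* y) :* ((a :* f) :* (b :* g)))
             refl _ a⁻¹ (genocchiTerm (suc t)) b⁻¹ (qbinom N (2 *ℕ i)) (qfact (2 *ℕ i)) (qfact (2 *ℕ suc t)) ⟩
      (1# + 1#) * (qbinom N (2 *ℕ i) * genocchiTerm (suc t)) * ((a⁻¹ * qfact (2 *ℕ i)) * (b⁻¹ * qfact (2 *ℕ suc t)))
        ≈⟨ *-congˡ (*-cong (inverseˡ _ (qfact-nonzero (2 *ℕ i))) (inverseˡ _ (qfact-nonzero (2 *ℕ suc t)))) ⟩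
      (1# + 1#) * (qbinom N (2 *ℕ i) * genocchiTerm (suc t)) * (1# * 1#)
        ≈⟨ trans (*-congˡ (*-identityˡ _)) (*-identityʳ _) ⟩
      (1# + 1#) * (qbinom N (2 *ℕ i) * genocchiTerm (suc t))
        ≡⟨ ≡.cong (λ j → (1# + 1#) * (qbinom N (2 *ℕ i) * genocchiTerm j)) m+1-i ⟨
      (1# + 1#) * (qbinom N (2 *ℕ i) * genocchiTerm (suc m ∸ i)) ∎
      where
      N = 2 *ℕ suc m
      N! = qfact N
      t = m ∸ i
      a⁻¹ = (qfact (2 *ℕ i)) ⁻¹
      b⁻¹ = (qfact (2 *ℕ suc t)) ⁻¹
      m+1-i : suc m ∸ i ≡ suc t
      m+1-i = ℕ.+-∸-assoc 1 i≤m
      N-2i : N ∸ 2 *ℕ i ≡ 2 *ℕ suc t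
      N-2i = ≡.trans (≡.sym (ℕ.*-distribˡ-∸ 2 (suc m) i)) (≡.cong (2 *ℕ_) m+1-i)

    rhsCoeff-even : ∀ m → rhsCoeff G (2 *ℕ suc m) * qfact (2 *ℕ suc m) ≈ (1# + 1#) * evenConvolution genocchiTerm m
    rhsCoeff-even m = begin
      sumTo (suc N) term * N!                     ≈⟨ *-comm _ _ ⟩
      N! * sumTo (suc N) term                     ≈⟨ sumTo-*ˡ (suc N) N! term ⟨
      sumTo (suc N) (λ i → N! * term i)           ≈⟨ sumTo-cong (suc N) (λ i _ → *-comm _ _) ⟩
      sumTo N h + h N                             ≈⟨ +-congˡ top ⟩
      sumTo N h + 0#                              ≈⟨ +-identityʳ _ ⟩
      sumTo N h                                   ≈⟨ sumTo-pairs (suc m) h ⟩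
      sumTo (suc m) (λ i → h (2 *ℕ i) + h (suc (2 *ℕ i)))
        ≈⟨ sumTo-cong (suc m) (λ i i≤m → trans (+-cong (rhsCoeff-even-term m i (ℕ.≤-pred i≤m)) (odd-term i)) (+-identityʳ _)) ⟩
      sumTo (suc m) (λ i → (1# + 1#) * (qbinom N (2 *ℕ i) * genocchiTerm (suc m ∸ i))) ≈⟨ sumTo-*ˡ (suc m) _ _ ⟩
      (1# + 1#) * evenConvolution genocchiTerm m  ∎
      where
      N = 2 *ℕ suc m
      N! = qfact N
      term h : ℕ → Carrier
      term i = ePlus i * seriesG G (N ∸ i)
      h i = term i * N!
      odd-term : ∀ i → h (suc (2 *ℕ i)) ≈ 0#
      odd-term i = trans (*-congʳ (*-congʳ (ePlus-odd i))) (trans (*-congʳ (zeroˡ _)) (zeroˡ _))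
      top : h N ≈ 0#
      top = trans (*-congʳ (*-congˡ (reflexive (≡.cong (seriesG G) (ℕ.n∸n≡0 N))))) (trans (*-congʳ (zeroʳ _)) (zeroˡ _))

    evenConvolution-genocchi : ∀ m → evenConvolution genocchiTerm m ≈ qint (2 *ℕ suc m)
    evenConvolution-genocchi m = *-cancelʳ 2≉0 (begin
      evenConvolution genocchiTerm m * (1# + 1#)     ≈⟨ *-comm _ _ ⟩
      (1# + 1#) * evenConvolution genocchiTerm m     ≈⟨ rhsCoeff-even m ⟨
      rhsCoeff G (2 *ℕ suc m) * qfact (2 *ℕ suc m)   ≈⟨ *-congʳ (G-genocchi (2 *ℕ suc m)) ⟨
      lhsCoeff (2 *ℕ suc m) * qfact (2 *ℕ suc m)     ≈⟨ lhsCoeff-even m ⟩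
      (1# + 1#) * qint (2 *ℕ suc m)                  ≈⟨ *-comm _ _ ⟩
      qint (2 *ℕ suc m) * (1# + 1#)                  ∎)

    ΛU-odd-genocchi : ∀ m → applyL μ (scale (sgn m) (U (2 *ℕ suc m ∸ 1))) ≈ qpoch (- q) (2 *ℕ suc m ∸ 1) * G (suc m)
    ΛU-odd-genocchi m = begin
      applyL μ (scale (sgn m) (U (2 *ℕ suc m ∸ 1)))  ≈⟨ applyL-scale (sgn m) (U (2 *ℕ suc m ∸ 1)) μ ⟩
      sgn m * ΛUprev μ (2 *ℕ suc m)                  ≈⟨ *-congˡ (evenConvolution-injective {λ j → ΛUprev μ (2 *ℕ j)} {genocchiTerm}
                                                          (λ m → trans (evenConvolution-ΛUprev m) (sym (evenConvolution-genocchi m))) m) ⟩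
      sgn m * (sgn m * G (suc m) * qpoch (- q) (suc (2 *ℕ m)))
        ≈⟨ solve 3 (λ s g p → s :* (s :* g :* p) := s :* s :* (p :* g)) refl _ _ _ ⟩
      sgn m * sgn m * (qpoch (- q) (suc (2 *ℕ m)) * G (suc m)) ≈⟨ trans (*-congʳ (sgn*sgn m)) (*-identityˡ _) ⟩
      qpoch (- q) (suc (2 *ℕ m)) * G (suc m)          ≡⟨ ≡.cong (λ n → qpoch (- q) (n ∸ 1) * G (suc m)) (ℕ.*-suc 2 m) ⟨
      qpoch (- q) (2 *ℕ suc m ∸ 1) * G (suc m)        ∎

theorem3p6 : ∀ {c ℓ} (F : Field c ℓ) →
    let open Field F
        open FieldDefs F
    in (∀ m → ¬ (fromℕ (suc m) ≈ 0#)) →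
       (q : Carrier) → ¬ (q ≈ 0#) → ¬ (q ≈ - 1#) →
       (∀ m → ¬ (QDefs.qint q (suc m) ≈ 0#)) →
       (μ : ℕ → Carrier) →
       (∀ n → applyL μ (QDefs.U q (2 *ℕ n)) ≈ iv0 n) →
       (G : ℕ → Carrier) → QDefs.IsGenocchi q G →
       ∀ n → 1 ≤ n →
         (QDefs.b q (2 *ℕ n ∸ 1) n
            ≈ applyL μ (scale (pow (- 1#) (n ∸ 1)) (QDefs.U q (2 *ℕ n ∸ 1))))
         × (applyL μ (scale (pow (- 1#) (n ∸ 1)) (QDefs.U q (2 *ℕ n ∸ 1)))
            ≈ QDefs.qpoch q (- q) (2 *ℕ n ∸ 1) * G n)
theorem3p6 F char≉0 q q≉0 _ [m+1]≉0 μ μ-U-even G G-genocchi (suc m) _ =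
  DiagonalOfB.b-diagonal q q≉0 μ μ-U-even m ,
  GenocchiMoments.ΛU-odd-genocchi q [m+1]≉0 2≉0 μ μ-U-even G G-genocchi m
  where
  open Field F
  open FieldTheory F
  2≉0 : ¬ (1# + 1# ≈ 0#)
  2≉0 2≈0 = char≉0 1 (trans (+-congˡ (+-identityʳ 1#)) 2≈0)
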